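{- Let $n\in\mathbb{N}$. The number of labeled split graphs on vertex set $\{1,\dots,n\}$ whose questioning set $Q$ satisfies $|Q|\ge 2$ equals $$2\sum_{q=2}^{n}\sum_{c=0}^{n-q}\binom{n}{q}\binom{n-q}{c}\left(2^{n-c-q}-1\right)^c,$$ with the convention $0^0=1$.
   Context: A split graph is a graph whose vertex set can be partitioned into a clique and an independent set (parts may be empty); such an ordered pair (clique, independent set) is a split partition. The questioning set $Q$ of a split graph is the set of vertices $v$ for which some split partition places $v$ in the clique and some split partition places $v$ in the independent set. -}

module Defs where

open import Data.Nat using (ℕ; zero; suc; _∸_; _^_; _≤_)
open import Data.Nat.Combinatorics using (_C_)
open import Data.Fin using (Fin)
open import Data.Fin.Properties using (any?; all?) renaming (_≟_ to _≟ᶠ_)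
open import Data.Fin.Subset using (Subset; _∈_; _∉_; inside; outside)
open import Data.Fin.Subset.Properties using (_∈?_; anySubset?)
open import Data.Vec using (Vec; []; _∷_; lookup)
open import Data.List using (List; []; _∷_; map; concatMap; filter; length; upTo)
open import Data.Nat.ListAction using (sum)
open import Data.Product using (Σ; ∃; ∃-syntax; _×_; _,_)
open import Data.Empty using (⊥)
open import Relation.Nullary using (¬_; Dec)
open import Relation.Nullary.Decidable using (_×-dec_; _→-dec_; ¬?)
open import Relation.Binary.PropositionalEquality using (_≡_; _≢_)
import Data.Nat as ℕ

-- A labeled (simple) graph on vertex set Fin n is given by its adjacency
-- rows: row i is the subset of neighbours of i.  It is a graph when the
-- adjacency relation is symmetric and irreflexive; every labeled simple graph
-- on Fin n corresponds to exactly one such Vec.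
AdjMat : ℕ → Set
AdjMat n = Vec (Subset n) n

Adj : ∀ {n} → AdjMat n → Fin n → Fin n → Set
Adj A i j = j ∈ lookup A i

IsGraph : ∀ {n} → AdjMat n → Set
IsGraph {n} A = (∀ (i j : Fin n) → Adj A i j → Adj A j i) × (∀ (i : Fin n) → ¬ Adj A i i)

IsSplitPartition : ∀ {n} → AdjMat n → Subset n → Set
IsSplitPartition {n} A K =
  (∀ (i j : Fin n) → i ∈ K → j ∈ K → i ≢ j → Adj A i j) ×
  (∀ (i j : Fin n) → i ∉ K → j ∉ K → ¬ Adj A i j)

IsSplit : ∀ {n} → AdjMat n → Set
IsSplit {n} A = ∃[ K ] IsSplitPartition {n} A K

InQ : ∀ {n} → AdjMat n → Fin n → Set
InQ {n} A v = (∃[ K ] (IsSplitPartition {n} A K × v ∈ K)) ×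
              (∃[ K ] (IsSplitPartition {n} A K × v ∉ K))

QAtLeast2 : ∀ {n} → AdjMat n → Set
QAtLeast2 {n} A = ∃[ u ] ∃[ v ] (u ≢ v × InQ {n} A u × InQ {n} A v)

Counted : ∀ {n} → AdjMat n → Set
Counted A = IsGraph A × IsSplit A × QAtLeast2 A

isSplitPartition? : ∀ {n} (A : AdjMat n) (K : Subset n) → Dec (IsSplitPartition A K)
isSplitPartition? A K =
  all? (λ i → all? (λ j → (i ∈? K) →-dec ((j ∈? K) →-dec (¬? (i ≟ᶠ j) →-dec (j ∈? lookup A i)))))
  ×-dec
  all? (λ i → all? (λ j → ¬? (i ∈? K) →-dec (¬? (j ∈? K) →-dec ¬? (j ∈? lookup A i))))

inQ? : ∀ {n} (A : AdjMat n) (v : Fin n) → Dec (InQ A v)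
inQ? A v = anySubset? (λ K → isSplitPartition? A K ×-dec (v ∈? K))
           ×-dec anySubset? (λ K → isSplitPartition? A K ×-dec ¬? (v ∈? K))

counted? : ∀ {n} (A : AdjMat n) → Dec (Counted A)
counted? A =
  (all? (λ i → all? (λ j → (j ∈? lookup A i) →-dec (i ∈? lookup A j)))
   ×-dec all? (λ i → ¬? (i ∈? lookup A i)))
  ×-dec anySubset? (isSplitPartition? A)
  ×-dec any? (λ u → any? (λ v → ¬? (u ≟ᶠ v) ×-dec inQ? A u ×-dec inQ? A v))

allVecs : ∀ {a} {X : Set a} → List X → (m : ℕ) → List (Vec X m)
allVecs xs zero = [] ∷ []
allVecs xs (suc m) = concatMap (λ x → map (x ∷_) (allVecs xs m)) xs

allSubsets : (n : ℕ) → List (Subset n)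
allSubsets n = allVecs (inside ∷ outside ∷ []) n

allAdjMats : (n : ℕ) → List (AdjMat n)
allAdjMats n = allVecs (allSubsets n) n

numSplitQ2 : ℕ → ℕ
numSplitQ2 n = length (filter counted? (allAdjMats n))

-- 2 * Σ_{q=2}^{n} Σ_{c=0}^{n-q} C(n,q) C(n-q,c) (2^(n-c-q) - 1)^c   (0^0 = 1)
-- q ranges over 2 + i for i ∈ upTo (n ∸ 1), i.e. q = 2,…,n (empty if n < 2);
-- c ranges over upTo (suc (n ∸ q)), i.e. c = 0,…,n-q.
formula : ℕ → ℕ
formula n = 2 ℕ.* sum (map (λ i → let q = 2 ℕ.+ i in
              sum (map (λ c → (n C q) ℕ.* ((n ∸ q) C c) ℕ.* ((2 ^ (n ∸ c ∸ q) ∸ 1) ^ c))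
                       (upTo (suc (n ∸ q)))))
            (upTo (n ∸ 1)))

module Submission where

-- For a split graph with |Q| ≥ 2, two vertices of Q are adjacent or not, and accordingly all of Q
-- is a clique or an independent set; complementation preserves split partitions up to swapping the
-- parts, hence preserves Q and exchanges the two cases. So the count is twice the number of graphs
-- in which Q is a clique. Such a graph assigns each vertex a role: in Q, in the clique part of every
-- split partition, or in the independent part of every one. Q is then adjacent to the clique vertices
-- and to nothing independent, and every clique vertex has a nonempty set of independent neighbours
-- (otherwise it could be moved). Conversely these local conditions characterise the roles, so the
-- graphs with q questioning and c clique vertices are counted by choosing the roles, C(n,q) C(n-q,c)
-- ways, and the c nonempty independent neighbourhoods, (2^(n-c-q) - 1)^c ways.

open import Defs
open import Data.Nat using (ℕ; zero; suc; _+_; _*_; _∸_; _^_; _≤_; _<_; _≤ᵇ_; s≤s; z≤n)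
open import Data.Nat.Properties hiding (suc-injective)
open import Data.Nat.ListAction using (sum)
open import Data.Nat.ListAction.Properties using (sum-++)
open import Data.Nat.Combinatorics using (_C_; nCk+nC[k+1]≡[n+1]C[k+1]; k>n⇒nCk≡0)
open import Data.Bool using (Bool; true; false; not; _∧_; _∨_)
open import Data.Bool.Properties
  using (¬-not; not-¬; not-injective; not-involutive; ∧-identityʳ; ∧-zeroʳ; ∨-zeroʳ; ∧-conicalˡ; ∧-conicalʳ;
         ∧-commutativeMonoid; T-≡) renaming (_≟_ to _≟ᵇ_)
open import Data.List using (List; []; _∷_; map; concatMap; filter; length; _++_; applyUpTo; upTo)
open import Data.List.Properties using (map-++; map-cong; map-∘)
open import Data.Vec using (Vec; []; _∷_; lookup; zipWith)
import Data.Vec as Vec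
open import Data.Vec.Properties
  using (∷-injectiveˡ; ∷-injectiveʳ; lookup-zipWith; []=⇒lookup; lookup⇒[]=; tabulate∘lookup; tabulate-cong;
         lookup∘tabulate; lookup-map; lookup-replicate)
open import Data.Fin using (Fin; zero; suc)
open import Data.Fin.Properties using (suc-injective; any?) renaming (_≟_ to _≟ᶠ_)
open import Data.Fin.Subset using (Subset; _∈_; _∉_; ∁)
open import Data.Fin.Subset.Properties using (_∈?_; x∈p⇒x∉∁p; x∈∁p⇒x∉p; x∉∁p⇒x∈p; x∉p⇒x∈∁p)
open import Data.Unit using (⊤; tt)
open import Data.Product using (_×_; _,_; proj₁; proj₂; ∃-syntax)
import Data.Product as Product
open import Data.Sum using (_⊎_; inj₁; inj₂)
import Data.Sum as Sum
open import Data.Empty using (⊥-elim)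
open import Function using (_∘_; id)
open import Function.Bundles using (Equivalence)
open import Relation.Nullary using (¬_; Dec; yes; no; does)
open import Relation.Nullary.Decidable using (_×-dec_)
open import Relation.Binary.Definitions using (DecidableEquality)
open import Relation.Binary.PropositionalEquality
open ≡-Reasoning
open import Algebra.Bundles using (CommutativeMonoid)
open import Algebra.Properties.CommutativeSemigroup +-commutativeSemigroup
  using () renaming (interchange to +-interchange)
open import Algebra.Properties.CommutativeSemigroup *-commutativeSemigroup
  using () renaming (interchange to *-interchange)
open import Algebra.Properties.CommutativeSemigroup
  (CommutativeMonoid.commutativeSemigroup ∧-commutativeMonoid)
  using () renaming (interchange to ∧-interchange)

-- Sums over lists

bools : List Bool
bools = true ∷ false ∷ []

𝟙 : Bool → ℕ
𝟙 true = 1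
𝟙 false = 0

𝟙-∧ : ∀ a b → 𝟙 (a ∧ b) ≡ 𝟙 a * 𝟙 b
𝟙-∧ true b = sym (+-identityʳ (𝟙 b))
𝟙-∧ false b = refl

∑ : ∀ {a} {X : Set a} → List X → (X → ℕ) → ℕ
∑ xs f = sum (map f xs)

module _ {a} {X : Set a} where

  ∑-++ : ∀ xs ys (f : X → ℕ) → ∑ (xs ++ ys) f ≡ ∑ xs f + ∑ ys f
  ∑-++ xs ys f = trans (cong sum (map-++ f xs ys)) (sum-++ (map f xs) (map f ys))

  ∑-cong : ∀ xs {f g : X → ℕ} → (∀ x → f x ≡ g x) → ∑ xs f ≡ ∑ xs g
  ∑-cong xs f≗g = cong sum (map-cong f≗g xs)

  ∑-vanishes : ∀ xs (f : X → ℕ) → (∀ x → f x ≡ 0) → ∑ xs f ≡ 0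
  ∑-vanishes [] f f≗0 = refl
  ∑-vanishes (x ∷ xs) f f≗0 = cong₂ _+_ (f≗0 x) (∑-vanishes xs f f≗0)

  ∑-+ : ∀ xs (f g : X → ℕ) → ∑ xs (λ x → f x + g x) ≡ ∑ xs f + ∑ xs g
  ∑-+ [] f g = refl
  ∑-+ (x ∷ xs) f g =
    trans (cong (f x + g x +_) (∑-+ xs f g)) (+-interchange (f x) (g x) (∑ xs f) (∑ xs g))

  ∑-*ˡ : ∀ xs c (f : X → ℕ) → ∑ xs (λ x → c * f x) ≡ c * ∑ xs f
  ∑-*ˡ [] c f = sym (*-zeroʳ c)
  ∑-*ˡ (x ∷ xs) c f = trans (cong (c * f x +_) (∑-*ˡ xs c f)) (sym (*-distribˡ-+ c (f x) _))

  length-filter≡∑ : ∀ {p} {P : X → Set p} (P? : ∀ x → Dec (P x)) xs →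
                    length (filter P? xs) ≡ ∑ xs (λ x → 𝟙 (does (P? x)))
  length-filter≡∑ P? [] = refl
  length-filter≡∑ P? (x ∷ xs) with does (P? x)
  ... | true = cong suc (length-filter≡∑ P? xs)
  ... | false = length-filter≡∑ P? xs

module _ {a b} {X : Set a} {Y : Set b} where

  ∑-map : ∀ xs (h : X → Y) (f : Y → ℕ) → ∑ (map h xs) f ≡ ∑ xs (f ∘ h)
  ∑-map xs h f = cong sum (sym (map-∘ xs))

  ∑-concatMap : ∀ xs (g : X → List Y) (f : Y → ℕ) → ∑ (concatMap g xs) f ≡ ∑ xs (λ x → ∑ (g x) f)
  ∑-concatMap [] g f = refl
  ∑-concatMap (x ∷ xs) g f =
    trans (∑-++ (g x) (concatMap g xs) f) (cong (∑ (g x) f +_) (∑-concatMap xs g f))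

  ∑-comm : ∀ xs ys (f : X → Y → ℕ) → ∑ xs (λ x → ∑ ys (f x)) ≡ ∑ ys (λ y → ∑ xs (λ x → f x y))
  ∑-comm [] ys f = sym (∑-vanishes ys _ (λ _ → refl))
  ∑-comm (x ∷ xs) ys f =
    trans (cong (∑ ys (f x) +_) (∑-comm xs ys f)) (sym (∑-+ ys (f x) _))

∑-*ʳ : ∀ {a} {X : Set a} xs c (f : X → ℕ) → ∑ xs (λ x → f x * c) ≡ ∑ xs f * c
∑-*ʳ xs c f = trans (∑-cong xs (λ x → *-comm (f x) c)) (trans (∑-*ˡ xs c f) (*-comm c (∑ xs f)))

-- Every element of X occurs in xs exactly once, phrased as the property of sums that is used.
Enumerates : ∀ {a} {X : Set a} → List X → Set a
Enumerates {X = X} xs = ∀ x₀ (f : X → ℕ) → (∀ x → x ≢ x₀ → f x ≡ 0) → ∑ xs f ≡ f x₀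

module _ {a} {X : Set a} (xs : List X) where

  ∑-allVecs-suc : ∀ m (f : Vec X (suc m) → ℕ) →
                  ∑ (allVecs xs (suc m)) f ≡ ∑ xs (λ x → ∑ (allVecs xs m) (λ v → f (x ∷ v)))
  ∑-allVecs-suc m f = trans (∑-concatMap xs _ f) (∑-cong xs (λ x → ∑-map (allVecs xs m) (x ∷_) f))

  ∑-allVecs-factor : ∀ m (f : Vec X (suc m) → ℕ) (F : X → ℕ) (G : Vec X m → ℕ) →
                     (∀ x v → f (x ∷ v) ≡ F x * G v) →
                     ∑ (allVecs xs (suc m)) f ≡ ∑ xs F * ∑ (allVecs xs m) G
  ∑-allVecs-factor m f F G f≡F*G = begin
    ∑ (allVecs xs (suc m)) f                           ≡⟨ ∑-allVecs-suc m f ⟩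
    ∑ xs (λ x → ∑ (allVecs xs m) (λ v → f (x ∷ v)))    ≡⟨ ∑-cong xs (λ x → ∑-cong (allVecs xs m) (f≡F*G x)) ⟩
    ∑ xs (λ x → ∑ (allVecs xs m) (λ v → F x * G v))    ≡⟨ ∑-cong xs (λ x → ∑-*ˡ (allVecs xs m) (F x) G) ⟩
    ∑ xs (λ x → F x * ∑ (allVecs xs m) G)              ≡⟨ ∑-cong xs (λ x → *-comm (F x) _) ⟩
    ∑ xs (λ x → ∑ (allVecs xs m) G * F x)              ≡⟨ ∑-*ˡ xs (∑ (allVecs xs m) G) F ⟩
    ∑ (allVecs xs m) G * ∑ xs F                        ≡⟨ *-comm _ (∑ xs F) ⟩
    ∑ xs F * ∑ (allVecs xs m) G                        ∎

  allVecs-enumerates : Enumerates xs → ∀ m → Enumerates (allVecs xs m)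
  allVecs-enumerates enum zero [] f _ = +-identityʳ (f [])
  allVecs-enumerates enum (suc m) (x₀ ∷ v₀) f f-point = begin
    ∑ (allVecs xs (suc m)) f                          ≡⟨ ∑-allVecs-suc m f ⟩
    ∑ xs (λ x → ∑ (allVecs xs m) (λ v → f (x ∷ v)))   ≡⟨ enum x₀ _ off-x₀ ⟩
    ∑ (allVecs xs m) (λ v → f (x₀ ∷ v))               ≡⟨ allVecs-enumerates enum m v₀ _ off-v₀ ⟩
    f (x₀ ∷ v₀)                                       ∎
    where
    off-x₀ : ∀ x → x ≢ x₀ → ∑ (allVecs xs m) (λ v → f (x ∷ v)) ≡ 0
    off-x₀ x x≢x₀ = ∑-vanishes (allVecs xs m) _ (λ v → f-point (x ∷ v) (x≢x₀ ∘ ∷-injectiveˡ))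
    off-v₀ : ∀ v → v ≢ v₀ → f (x₀ ∷ v) ≡ 0
    off-v₀ v v≢v₀ = f-point (x₀ ∷ v) (v≢v₀ ∘ ∷-injectiveʳ)

  ∑-allVecs-map : (g : X → X) → (∀ h → ∑ xs (h ∘ g) ≡ ∑ xs h) →
                  ∀ m (h : Vec X m → ℕ) → ∑ (allVecs xs m) (h ∘ Vec.map g) ≡ ∑ (allVecs xs m) h
  ∑-allVecs-map g g-invariant zero h = refl
  ∑-allVecs-map g g-invariant (suc m) h = begin
    ∑ (allVecs xs (suc m)) (h ∘ Vec.map g)
      ≡⟨ ∑-allVecs-suc m _ ⟩
    ∑ xs (λ x → ∑ (allVecs xs m) (λ v → h (g x ∷ Vec.map g v)))
      ≡⟨ ∑-cong xs (λ x → ∑-allVecs-map g g-invariant m _) ⟩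
    ∑ xs (λ x → ∑ (allVecs xs m) (λ v → h (g x ∷ v)))
      ≡⟨ g-invariant _ ⟩
    ∑ xs (λ x → ∑ (allVecs xs m) (λ v → h (x ∷ v)))
      ≡⟨ ∑-allVecs-suc m h ⟨
    ∑ (allVecs xs (suc m)) h
      ∎

∑-allVecs-zipWith : ∀ {A B Z : Set} (xs : List A) (ys : List B) (f : A → B → Z) m (h : Vec Z m → ℕ) →
  ∑ (allVecs (concatMap (λ x → map (f x) ys) xs) m) h ≡
  ∑ (allVecs xs m) (λ u → ∑ (allVecs ys m) (λ v → h (zipWith f u v)))
∑-allVecs-zipWith xs ys f zero h = cong (_+ 0) (sym (+-identityʳ (h [])))
∑-allVecs-zipWith xs ys f (suc m) h = begin
  ∑ (allVecs zs (suc m)) h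
    ≡⟨ ∑-allVecs-suc zs m h ⟩
  ∑ zs (λ z → ∑ (allVecs zs m) (λ w → h (z ∷ w)))
    ≡⟨ ∑-concatMap xs _ _ ⟩
  ∑ xs (λ x → ∑ (map (f x) ys) (λ z → ∑ (allVecs zs m) (λ w → h (z ∷ w))))
    ≡⟨ ∑-cong xs (λ x → ∑-map ys (f x) _) ⟩
  ∑ xs (λ x → ∑ ys (λ y → ∑ (allVecs zs m) (λ w → h (f x y ∷ w))))
    ≡⟨ ∑-cong xs (λ x → ∑-cong ys (λ y → ∑-allVecs-zipWith xs ys f m _)) ⟩
  ∑ xs (λ x → ∑ ys (λ y → ∑ (allVecs xs m) (λ u → ∑ (allVecs ys m) (λ v → h (f x y ∷ zipWith f u v)))))
    ≡⟨ ∑-cong xs (λ x → ∑-comm ys (allVecs xs m) _) ⟩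
  ∑ xs (λ x → ∑ (allVecs xs m) (λ u → ∑ ys (λ y → ∑ (allVecs ys m) (λ v → h (f x y ∷ zipWith f u v)))))
    ≡⟨ ∑-cong xs (λ x → ∑-cong (allVecs xs m) (λ u → ∑-allVecs-suc ys m _)) ⟨
  ∑ xs (λ x → ∑ (allVecs xs m) (λ u → ∑ (allVecs ys (suc m)) (λ v → h (zipWith f (x ∷ u) v))))
    ≡⟨ ∑-allVecs-suc xs m _ ⟨
  ∑ (allVecs xs (suc m)) (λ u → ∑ (allVecs ys (suc m)) (λ v → h (zipWith f u v)))
    ∎
  where
  zs = concatMap (λ x → map (f x) ys) xs

bools-enumerate : Enumerates bools
bools-enumerate true f f-point =
  trans (cong (λ y → f true + (y + 0)) (f-point false λ ())) (+-identityʳ (f true))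
bools-enumerate false f f-point =
  trans (cong (_+ (f false + 0)) (f-point true λ ())) (+-identityʳ (f false))

allSubsets-enumerate : ∀ n → Enumerates (allSubsets n)
allSubsets-enumerate = allVecs-enumerates _ bools-enumerate

∑-bools-not : ∀ (h : Bool → ℕ) → ∑ bools (h ∘ not) ≡ ∑ bools h
∑-bools-not h = begin
  h false + (h true + 0)   ≡⟨ cong (h false +_) (+-identityʳ (h true)) ⟩
  h false + h true         ≡⟨ +-comm (h false) (h true) ⟩
  h true + h false         ≡⟨ cong (h true +_) (+-identityʳ (h false)) ⟨
  h true + (h false + 0)   ∎

-- Sums over ranges and binomial sums

∑< : ℕ → (ℕ → ℕ) → ℕ
∑< zero g = 0
∑< (suc m) g = g 0 + ∑< m (g ∘ suc)

∑-applyUpTo : ∀ m (f g : ℕ → ℕ) → ∑ (applyUpTo f m) g ≡ ∑< m (g ∘ f)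
∑-applyUpTo zero f g = refl
∑-applyUpTo (suc m) f g = cong (g (f 0) +_) (∑-applyUpTo m (f ∘ suc) g)

∑-upTo : ∀ m (g : ℕ → ℕ) → ∑ (upTo m) g ≡ ∑< m g
∑-upTo m g = ∑-applyUpTo m id g

∑<-cong : ∀ m {g h : ℕ → ℕ} → (∀ c → c < m → g c ≡ h c) → ∑< m g ≡ ∑< m h
∑<-cong zero g≗h = refl
∑<-cong (suc m) g≗h = cong₂ _+_ (g≗h 0 (s≤s z≤n)) (∑<-cong m (λ c c<m → g≗h (suc c) (s≤s c<m)))

∑<-vanishes : ∀ m (g : ℕ → ℕ) → (∀ c → g c ≡ 0) → ∑< m g ≡ 0
∑<-vanishes zero g g≗0 = refl
∑<-vanishes (suc m) g g≗0 = cong₂ _+_ (g≗0 0) (∑<-vanishes m (g ∘ suc) (g≗0 ∘ suc))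

∑<-+ : ∀ m (f g : ℕ → ℕ) → ∑< m (λ c → f c + g c) ≡ ∑< m f + ∑< m g
∑<-+ zero f g = refl
∑<-+ (suc m) f g =
  trans (cong (f 0 + g 0 +_) (∑<-+ m (f ∘ suc) (g ∘ suc))) (+-interchange (f 0) (g 0) _ _)

∑<-*ˡ : ∀ m a (f : ℕ → ℕ) → ∑< m (λ c → a * f c) ≡ a * ∑< m f
∑<-*ˡ zero a f = sym (*-zeroʳ a)
∑<-*ˡ (suc m) a f = trans (cong (a * f 0 +_) (∑<-*ˡ m a (f ∘ suc))) (sym (*-distribˡ-+ a (f 0) _))

∑<-last : ∀ m (g : ℕ → ℕ) → ∑< (suc m) g ≡ ∑< m g + g m
∑<-last zero g = +-identityʳ (g 0)
∑<-last (suc m) g = trans (cong (g 0 +_) (∑<-last m (g ∘ suc))) (sym (+-assoc (g 0) _ _))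

∑<-from-2 : ∀ n (g : ℕ → ℕ) → g 0 ≡ 0 → g 1 ≡ 0 → ∑< (suc n) g ≡ ∑< (n ∸ 1) (λ i → g (2 + i))
∑<-from-2 zero g g0 g1 = trans (+-identityʳ (g 0)) g0
∑<-from-2 (suc m) g g0 g1 = cong₂ _+_ g0 (cong (_+ ∑< m (λ i → g (2 + i))) g1)

binomialSum : ℕ → (ℕ → ℕ) → ℕ
binomialSum n g = ∑< (suc n) (λ c → (n C c) * g c)

binomialSum-cong : ∀ n {g h : ℕ → ℕ} → (∀ c → c ≤ n → g c ≡ h c) → binomialSum n g ≡ binomialSum n h
binomialSum-cong n g≗h = ∑<-cong (suc n) (λ c c≤n → cong ((n C c) *_) (g≗h c (≤-pred c≤n)))

binomialSum-+ : ∀ n (f g : ℕ → ℕ) → binomialSum n (λ c → f c + g c) ≡ binomialSum n f + binomialSum n g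
binomialSum-+ n f g =
  trans (∑<-cong (suc n) (λ c _ → *-distribˡ-+ (n C c) (f c) (g c)))
        (∑<-+ (suc n) (λ c → (n C c) * f c) (λ c → (n C c) * g c))

binomialSum-vanishes : ∀ n → binomialSum n (λ _ → 0) ≡ 0
binomialSum-vanishes n = ∑<-vanishes (suc n) _ (λ c → *-zeroʳ (n C c))

binomialSum-suc : ∀ n (g : ℕ → ℕ) → binomialSum (suc n) g ≡ binomialSum n (g ∘ suc) + binomialSum n g
binomialSum-suc n g = begin
  binomialSum (suc n) g
    ≡⟨⟩
  g 0 + 0 + ∑< (suc n) (λ c → (suc n C suc c) * g (suc c))
    ≡⟨ cong (g 0 + 0 +_) (∑<-cong (suc n) (λ c _ → pascal c)) ⟩
  g 0 + 0 + ∑< (suc n) (λ c → (n C c) * g (suc c) + (n C suc c) * g (suc c))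
    ≡⟨ cong (g 0 + 0 +_) (∑<-+ (suc n) (λ c → (n C c) * g (suc c)) upper) ⟩
  g 0 + 0 + (binomialSum n (g ∘ suc) + ∑< (suc n) upper)
    ≡⟨ cong (λ s → g 0 + 0 + (binomialSum n (g ∘ suc) + s)) (∑<-last n upper) ⟩
  g 0 + 0 + (binomialSum n (g ∘ suc) + (∑< n upper + (n C suc n) * g (suc n)))
    ≡⟨ cong (λ k → g 0 + 0 + (binomialSum n (g ∘ suc) + (∑< n upper + k * g (suc n)))) (k>n⇒nCk≡0 (n<1+n n)) ⟩
  g 0 + 0 + (binomialSum n (g ∘ suc) + (∑< n upper + 0))
    ≡⟨ cong (λ s → g 0 + 0 + (binomialSum n (g ∘ suc) + s)) (+-identityʳ _) ⟩
  g 0 + 0 + (binomialSum n (g ∘ suc) + ∑< n upper)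
    ≡⟨ x+[y+z]≡y+[x+z] (g 0 + 0) (binomialSum n (g ∘ suc)) _ ⟩
  binomialSum n (g ∘ suc) + binomialSum n g
    ∎
  where
  upper : ℕ → ℕ
  upper c = (n C suc c) * g (suc c)
  pascal : ∀ c → (suc n C suc c) * g (suc c) ≡ (n C c) * g (suc c) + (n C suc c) * g (suc c)
  pascal c = trans (cong (_* g (suc c)) (sym (nCk+nC[k+1]≡[n+1]C[k+1] n c)))
                   (*-distribʳ-+ (g (suc c)) (n C c) (n C suc c))
  x+[y+z]≡y+[x+z] : ∀ x y z → x + (y + z) ≡ y + (x + z)
  x+[y+z]≡y+[x+z] x y z = trans (sym (+-assoc x y z)) (trans (cong (_+ z) (+-comm x y)) (+-assoc y x z))

-- Graphs and adjacency matrices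

vec-ext : ∀ {a} {A : Set a} {n} (u v : Vec A n) → (∀ i → lookup u i ≡ lookup v i) → u ≡ v
vec-ext u v u≗v = trans (sym (tabulate∘lookup u)) (trans (tabulate-cong u≗v) (tabulate∘lookup v))

bool-ext : ∀ {a b : Bool} → (a ≡ true → b ≡ true) → (b ≡ true → a ≡ true) → a ≡ b
bool-ext {true} {true} _ _ = refl
bool-ext {true} {false} a⇒b _ = sym (a⇒b refl)
bool-ext {false} {true} _ b⇒a = b⇒a refl
bool-ext {false} {false} _ _ = refl

entry : ∀ {n} → AdjMat n → Fin n → Fin n → Bool
entry A i j = lookup (lookup A i) j

Adj⇒entry : ∀ {n} (A : AdjMat n) i j → Adj A i j → entry A i j ≡ true
Adj⇒entry A i j = []=⇒lookup

entry⇒Adj : ∀ {n} (A : AdjMat n) i j → entry A i j ≡ true → Adj A i j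
entry⇒Adj A i j = lookup⇒[]= j (lookup A i)

IsGraph⇒entry-sym : ∀ {n} (A : AdjMat n) → IsGraph A → ∀ i j → entry A i j ≡ true → entry A j i ≡ true
IsGraph⇒entry-sym A (sym-Adj , _) i j e =
  Adj⇒entry A j i (sym-Adj i j (entry⇒Adj A i j e))

IsGraph⇒entry-irrefl : ∀ {n} (A : AdjMat n) → IsGraph A → ∀ i → entry A i i ≢ true
IsGraph⇒entry-irrefl A (_ , irrefl-Adj) i e = irrefl-Adj i (entry⇒Adj A i i e)

consMat : ∀ {n} → Bool → Subset n → Subset n → AdjMat n → AdjMat (suc n)
consMat b N c R = (b ∷ N) ∷ zipWith _∷_ c R

entry-consMat-suc-zero : ∀ {n} b (N c : Subset n) R i → entry (consMat b N c R) (suc i) zero ≡ lookup c i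
entry-consMat-suc-zero b N c R i = cong (λ row → lookup row zero) (lookup-zipWith _∷_ i c R)

entry-consMat-suc-suc : ∀ {n} b (N c : Subset n) R i j → entry (consMat b N c R) (suc i) (suc j) ≡ entry R i j
entry-consMat-suc-suc b N c R i j = cong (λ row → lookup row (suc j)) (lookup-zipWith _∷_ i c R)

IsGraph-consMat : ∀ {n} b (N c : Subset n) R → IsGraph (consMat b N c R) → b ≡ false × c ≡ N × IsGraph R
IsGraph-consMat b N c R gr = corner , column , minor-sym , minor-irrefl
  where
  A = consMat b N c R
  corner : b ≡ false
  corner = ¬-not (IsGraph⇒entry-irrefl A gr zero)
  column : c ≡ N
  column = vec-ext c N (λ i → bool-ext
    (λ cᵢ → IsGraph⇒entry-sym A gr (suc i) zero (trans (entry-consMat-suc-zero b N c R i) cᵢ))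
    (λ Nᵢ → trans (sym (entry-consMat-suc-zero b N c R i)) (IsGraph⇒entry-sym A gr zero (suc i) Nᵢ)))
  minor-sym : ∀ i j → Adj R i j → Adj R j i
  minor-sym i j Rᵢⱼ = entry⇒Adj R j i (trans (sym (entry-consMat-suc-suc b N c R j i))
    (IsGraph⇒entry-sym A gr (suc i) (suc j)
      (trans (entry-consMat-suc-suc b N c R i j) (Adj⇒entry R i j Rᵢⱼ))))
  minor-irrefl : ∀ i → ¬ Adj R i i
  minor-irrefl i Rᵢᵢ =
    IsGraph⇒entry-irrefl A gr (suc i) (trans (entry-consMat-suc-suc b N c R i i) (Adj⇒entry R i i Rᵢᵢ))

-- A graph on Fin (suc n) is the neighbourhood of vertex 0 among the other vertices together with
-- the graph induced on them; this lists every labeled graph exactly once.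
Graph : ℕ → Set
Graph zero = ⊤
Graph (suc n) = Subset n × Graph n

allGraphs : (n : ℕ) → List (Graph n)
allGraphs zero = tt ∷ []
allGraphs (suc n) = concatMap (λ N → map (N ,_) (allGraphs n)) (allSubsets n)

∑-allGraphs-suc : ∀ n (f : Graph (suc n) → ℕ) →
                  ∑ (allGraphs (suc n)) f ≡ ∑ (allSubsets n) (λ N → ∑ (allGraphs n) (λ G → f (N , G)))
∑-allGraphs-suc n f =
  trans (∑-concatMap (allSubsets n) _ f) (∑-cong (allSubsets n) (λ N → ∑-map (allGraphs n) (N ,_) f))

adj : ∀ {n} → Graph n → Fin n → Fin n → Bool
adj {suc n} (N , G) zero zero = false
adj {suc n} (N , G) zero (suc j) = lookup N j
adj {suc n} (N , G) (suc i) zero = lookup N i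
adj {suc n} (N , G) (suc i) (suc j) = adj G i j

adj-sym : ∀ {n} (G : Graph n) i j → adj G i j ≡ adj G j i
adj-sym {suc n} (N , G) zero zero = refl
adj-sym {suc n} (N , G) zero (suc j) = refl
adj-sym {suc n} (N , G) (suc i) zero = refl
adj-sym {suc n} (N , G) (suc i) (suc j) = adj-sym G i j

adj-irrefl : ∀ {n} (G : Graph n) i → adj G i i ≡ false
adj-irrefl {suc n} (N , G) zero = refl
adj-irrefl {suc n} (N , G) (suc i) = adj-irrefl G i

toAdjMat : ∀ {n} → Graph n → AdjMat n
toAdjMat {zero} _ = []
toAdjMat {suc n} (N , G) = consMat false N N (toAdjMat G)

entry-toAdjMat : ∀ {n} (G : Graph n) i j → entry (toAdjMat G) i j ≡ adj G i j
entry-toAdjMat {suc n} (N , G) zero zero = refl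
entry-toAdjMat {suc n} (N , G) zero (suc j) = refl
entry-toAdjMat {suc n} (N , G) (suc i) zero = entry-consMat-suc-zero false N N (toAdjMat G) i
entry-toAdjMat {suc n} (N , G) (suc i) (suc j) =
  trans (entry-consMat-suc-suc false N N (toAdjMat G) i j) (entry-toAdjMat G i j)

Adj⇒adj : ∀ {n} (G : Graph n) i j → Adj (toAdjMat G) i j → adj G i j ≡ true
Adj⇒adj G i j a = trans (sym (entry-toAdjMat G i j)) (Adj⇒entry (toAdjMat G) i j a)

adj⇒Adj : ∀ {n} (G : Graph n) i j → adj G i j ≡ true → Adj (toAdjMat G) i j
adj⇒Adj G i j e = entry⇒Adj (toAdjMat G) i j (trans (entry-toAdjMat G i j) e)

toAdjMat-isGraph : ∀ {n} (G : Graph n) → IsGraph (toAdjMat G)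
toAdjMat-isGraph G =
  (λ i j a → adj⇒Adj G j i (trans (adj-sym G j i) (Adj⇒adj G i j a))) ,
  (λ i a → not-¬ (adj-irrefl G i) (Adj⇒adj G i i a))

∑-allAdjMats : ∀ n (g : AdjMat n → ℕ) → (∀ A → ¬ IsGraph A → g A ≡ 0) →
               ∑ (allAdjMats n) g ≡ ∑ (allGraphs n) (g ∘ toAdjMat)
∑-allAdjMats zero g _ = refl
∑-allAdjMats (suc n) g g-graphs = begin
  ∑ (allAdjMats (suc n)) g
    ≡⟨ ∑-allVecs-suc (allSubsets (suc n)) n g ⟩
  ∑ (allSubsets (suc n)) (λ r → ∑ (allVecs (allSubsets (suc n)) n) (λ rows → g (r ∷ rows)))
    ≡⟨ ∑-cong (allSubsets (suc n)) (λ r → ∑-allVecs-zipWith _ Ns _∷_ n _) ⟩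
  ∑ (allSubsets (suc n)) (λ r → ∑ Ns (λ c → ∑ Rs (λ R → g (r ∷ zipWith _∷_ c R))))
    ≡⟨ ∑-allVecs-suc _ n _ ⟩
  ∑ bools (λ b → ∑ Ns (λ N → ∑ Ns (λ c → ∑ Rs (g ∘ consMat b N c))))
    ≡⟨ bools-enumerate false _ corner-false ⟩
  ∑ Ns (λ N → ∑ Ns (λ c → ∑ Rs (g ∘ consMat false N c)))
    ≡⟨ ∑-cong Ns (λ N → allSubsets-enumerate n N _ (column≡row N)) ⟩
  ∑ Ns (λ N → ∑ Rs (g ∘ consMat false N N))
    ≡⟨ ∑-cong Ns (λ N → ∑-allAdjMats n (g ∘ consMat false N N) (minor-graph N)) ⟩
  ∑ Ns (λ N → ∑ (allGraphs n) (λ G → g (toAdjMat (N , G))))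
    ≡⟨ ∑-allGraphs-suc n (g ∘ toAdjMat) ⟨
  ∑ (allGraphs (suc n)) (g ∘ toAdjMat)
    ∎
  where
  Ns = allSubsets n
  Rs = allAdjMats n
  corner-false : ∀ b → b ≢ false → ∑ Ns (λ N → ∑ Ns (λ c → ∑ Rs (g ∘ consMat b N c))) ≡ 0
  corner-false b b≢false = ∑-vanishes Ns _ λ N → ∑-vanishes Ns _ λ c → ∑-vanishes Rs _ λ R →
    g-graphs (consMat b N c R) (b≢false ∘ proj₁ ∘ IsGraph-consMat b N c R)
  column≡row : ∀ N c → c ≢ N → ∑ Rs (g ∘ consMat false N c) ≡ 0
  column≡row N c c≢N = ∑-vanishes Rs _ λ R →
    g-graphs (consMat false N c R) (c≢N ∘ proj₁ ∘ proj₂ ∘ IsGraph-consMat false N c R)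
  minor-graph : ∀ N R → ¬ IsGraph R → g (consMat false N N R) ≡ 0
  minor-graph N R ¬R = g-graphs (consMat false N N R) (¬R ∘ proj₂ ∘ proj₂ ∘ IsGraph-consMat false N N R)

complement : ∀ {n} → Graph n → Graph n
complement {zero} G = G
complement {suc n} (N , G) = ∁ N , complement G

adj-complement : ∀ {n} (G : Graph n) x y → x ≢ y → adj (complement G) x y ≡ not (adj G x y)
adj-complement {suc n} (N , G) zero zero 0≢0 = ⊥-elim (0≢0 refl)
adj-complement {suc n} (N , G) zero (suc j) _ = lookup-map j not N
adj-complement {suc n} (N , G) (suc i) zero _ = lookup-map i not N
adj-complement {suc n} (N , G) (suc i) (suc j) i≢j = adj-complement G i j (i≢j ∘ cong suc)

complement-involutive : ∀ {n} (G : Graph n) → complement (complement G) ≡ G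
complement-involutive {zero} G = refl
complement-involutive {suc n} (N , G) =
  cong₂ _,_ (vec-ext (∁ (∁ N)) N (λ i → trans (lookup-map i not (∁ N)) (trans (cong not (lookup-map i not N))
                                                                               (not-involutive _))))
            (complement-involutive G)

∑-complement : ∀ n (f : Graph n → ℕ) → ∑ (allGraphs n) (f ∘ complement) ≡ ∑ (allGraphs n) f
∑-complement zero f = refl
∑-complement (suc n) f = begin
  ∑ (allGraphs (suc n)) (f ∘ complement)
    ≡⟨ ∑-allGraphs-suc n (f ∘ complement) ⟩
  ∑ (allSubsets n) (λ N → ∑ (allGraphs n) (λ G → f (∁ N , complement G)))
    ≡⟨ ∑-cong (allSubsets n) (λ N → ∑-complement n (λ G → f (∁ N , G))) ⟩
  ∑ (allSubsets n) (λ N → ∑ (allGraphs n) (λ G → f (∁ N , G)))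
    ≡⟨ ∑-allVecs-map bools not ∑-bools-not n (λ N → ∑ (allGraphs n) (λ G → f (N , G))) ⟩
  ∑ (allSubsets n) (λ N → ∑ (allGraphs n) (λ G → f (N , G)))
    ≡⟨ ∑-allGraphs-suc n f ⟨
  ∑ (allGraphs (suc n)) f
    ∎

-- Role vectors

data Role : Set where
  questioning clique independent : Role

_≟ʳ_ : DecidableEquality Role
questioning ≟ʳ questioning = yes refl
questioning ≟ʳ clique = no λ ()
questioning ≟ʳ independent = no λ ()
clique ≟ʳ questioning = no λ ()
clique ≟ʳ clique = yes refl
clique ≟ʳ independent = no λ ()
independent ≟ʳ questioning = no λ ()
independent ≟ʳ clique = no λ ()
independent ≟ʳ independent = yes refl

allRoles : List Role
allRoles = questioning ∷ clique ∷ independent ∷ []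

allRoles-enumerate : Enumerates allRoles
allRoles-enumerate questioning f f-point =
  trans (cong₂ (λ a b → f questioning + (a + (b + 0))) (f-point clique λ ()) (f-point independent λ ()))
        (+-identityʳ _)
allRoles-enumerate clique f f-point =
  trans (cong₂ (λ a b → a + (f clique + (b + 0))) (f-point questioning λ ()) (f-point independent λ ()))
        (+-identityʳ _)
allRoles-enumerate independent f f-point =
  trans (cong₂ (λ a b → a + (b + (f independent + 0))) (f-point questioning λ ()) (f-point clique λ ()))
        (+-identityʳ _)

Roles : ℕ → Set
Roles = Vec Role

count : ∀ {n} → Role → Roles n → ℕ
count r = Vec.count (_≟ʳ r)

isIndependent : Role → Bool
isIndependent independent = true
isIndependent _ = false

isIndependent-true : ∀ {r} → isIndependent r ≡ true → r ≡ independent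
isIndependent-true {independent} _ = refl

count-total : ∀ {n} (L : Roles n) → count clique L + (count questioning L + count independent L) ≡ n
count-total [] = refl
count-total (questioning ∷ L) = trans (+-suc (count clique L) _) (cong suc (count-total L))
count-total (clique ∷ L) = cong suc (count-total L)
count-total (independent ∷ L) =
  trans (cong (count clique L +_) (+-suc (count questioning L) _))
        (trans (+-suc (count clique L) _) (cong suc (count-total L)))

count-independent : ∀ {n} (L : Roles n) → count independent L ≡ n ∸ count clique L ∸ count questioning L
count-independent {n} L = sym (begin
  n ∸ count clique L ∸ count questioning L
    ≡⟨ cong (λ m → m ∸ count clique L ∸ count questioning L) (count-total L) ⟨
  count clique L + (count questioning L + count independent L) ∸ count clique L ∸ count questioning L
    ≡⟨ cong (_∸ count questioning L) (m+n∸m≡n (count clique L) _) ⟩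
  count questioning L + count independent L ∸ count questioning L
    ≡⟨ m+n∸m≡n (count questioning L) _ ⟩
  count independent L
    ∎)

one-questioning : ∀ {n} (L : Roles n) → 1 ≤ count questioning L → ∃[ u ] lookup L u ≡ questioning
one-questioning (questioning ∷ L) _ = zero , refl
one-questioning (clique ∷ L) 1≤ = Product.map suc id (one-questioning L 1≤)
one-questioning (independent ∷ L) 1≤ = Product.map suc id (one-questioning L 1≤)

2≤count⇒questioning-pair : ∀ {n} (L : Roles n) → 2 ≤ count questioning L →
                           ∃[ u ] ∃[ v ] (u ≢ v × lookup L u ≡ questioning × lookup L v ≡ questioning)
2≤count⇒questioning-pair (questioning ∷ L) (s≤s 1≤) =
  let v , Lv = one-questioning L 1≤ in zero , suc v , (λ ()) , refl , Lv
2≤count⇒questioning-pair (clique ∷ L) 2≤ =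
  let u , v , u≢v , Lu , Lv = 2≤count⇒questioning-pair L 2≤ in suc u , suc v , u≢v ∘ suc-injective , Lu , Lv
2≤count⇒questioning-pair (independent ∷ L) 2≤ =
  let u , v , u≢v , Lu , Lv = 2≤count⇒questioning-pair L 2≤ in suc u , suc v , u≢v ∘ suc-injective , Lu , Lv

questioning⇒1≤count : ∀ {n} (L : Roles n) u → lookup L u ≡ questioning → 1 ≤ count questioning L
questioning⇒1≤count (questioning ∷ L) u _ = s≤s z≤n
questioning⇒1≤count (clique ∷ L) (suc u) Lu = questioning⇒1≤count L u Lu
questioning⇒1≤count (independent ∷ L) (suc u) Lu = questioning⇒1≤count L u Lu

questioning⇒2≤count : ∀ {n} (L : Roles n) u v → u ≢ v → lookup L u ≡ questioning → lookup L v ≡ questioning →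
                      2 ≤ count questioning L
questioning⇒2≤count (r ∷ L) zero zero 0≢0 _ _ = ⊥-elim (0≢0 refl)
questioning⇒2≤count (questioning ∷ L) zero (suc v) _ _ Lv = s≤s (questioning⇒1≤count L v Lv)
questioning⇒2≤count (questioning ∷ L) (suc u) zero _ Lu _ = s≤s (questioning⇒1≤count L u Lu)
questioning⇒2≤count (questioning ∷ L) (suc u) (suc v) u≢v Lu Lv =
  m≤n⇒m≤1+n (questioning⇒2≤count L u v (u≢v ∘ cong suc) Lu Lv)
questioning⇒2≤count (clique ∷ L) (suc u) (suc v) u≢v Lu Lv =
  questioning⇒2≤count L u v (u≢v ∘ cong suc) Lu Lv
questioning⇒2≤count (independent ∷ L) (suc u) (suc v) u≢v Lu Lv =
  questioning⇒2≤count L u v (u≢v ∘ cong suc) Lu Lv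

trinomialSum : ℕ → (ℕ → ℕ → ℕ) → ℕ
trinomialSum n F = binomialSum n (λ q → binomialSum (n ∸ q) (F q))

∑-allRoles-trinomial : ∀ n (F : ℕ → ℕ → ℕ) →
  ∑ (allVecs allRoles n) (λ L → F (count questioning L) (count clique L)) ≡ trinomialSum n F
∑-allRoles-trinomial zero F = trans (+-identityʳ (F 0 0)) (sym (begin
  1 * (1 * F 0 0 + 0) + 0   ≡⟨ +-identityʳ _ ⟩
  1 * (1 * F 0 0 + 0)       ≡⟨ *-identityˡ _ ⟩
  1 * F 0 0 + 0             ≡⟨ +-identityʳ _ ⟩
  1 * F 0 0                 ≡⟨ *-identityˡ _ ⟩
  F 0 0                     ∎))
∑-allRoles-trinomial (suc n) F = begin
  ∑ (allVecs allRoles (suc n)) (λ L → F (count questioning L) (count clique L))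
    ≡⟨ ∑-allVecs-suc allRoles n _ ⟩
  ∑-F (λ q c → F (suc q) c) + (∑-F (λ q c → F q (suc c)) + (∑-F F + 0))
    ≡⟨ cong₂ _+_ (∑-allRoles-trinomial n (λ q c → F (suc q) c))
                 (cong₂ _+_ (∑-allRoles-trinomial n (λ q c → F q (suc c)))
                            (trans (+-identityʳ _) (∑-allRoles-trinomial n F))) ⟩
  trinomialSum n (λ q c → F (suc q) c) + (trinomialSum n (λ q c → F q (suc c)) + trinomialSum n F)
    ≡⟨ cong (trinomialSum n (λ q c → F (suc q) c) +_)
         (binomialSum-+ n (λ q → binomialSum (n ∸ q) (λ c → F q (suc c))) (λ q → binomialSum (n ∸ q) (F q))) ⟨
  trinomialSum n (λ q c → F (suc q) c) +
  binomialSum n (λ q → binomialSum (n ∸ q) (λ c → F q (suc c)) + binomialSum (n ∸ q) (F q))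
    ≡⟨ cong (trinomialSum n (λ q c → F (suc q) c) +_) (binomialSum-cong n (λ q q≤n → sym (shrink q q≤n))) ⟩
  trinomialSum n (λ q c → F (suc q) c) + binomialSum n (λ q → binomialSum (suc n ∸ q) (F q))
    ≡⟨ binomialSum-suc n (λ q → binomialSum (suc n ∸ q) (F q)) ⟨
  trinomialSum (suc n) F
    ∎
  where
  ∑-F : (ℕ → ℕ → ℕ) → ℕ
  ∑-F G = ∑ (allVecs allRoles n) (λ L → G (count questioning L) (count clique L))
  shrink : ∀ q → q ≤ n →
           binomialSum (suc n ∸ q) (F q) ≡ binomialSum (n ∸ q) (λ c → F q (suc c)) + binomialSum (n ∸ q) (F q)
  shrink q q≤n = trans (cong (λ m → binomialSum m (F q)) (+-∸-assoc 1 q≤n)) (binomialSum-suc (n ∸ q) (F q))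

-- Counting the graphs that fit a role vector

-- Whether an edge (true) or non-edge (false) between vertices of the given roles is allowed
-- when the questioning vertices form a clique.
compatible : Role → Role → Bool → Bool
compatible independent independent e = not e
compatible independent questioning e = not e
compatible questioning independent e = not e
compatible independent clique _ = true
compatible clique independent _ = true
compatible _ _ e = e

rowFits : ∀ {n} → Role → Subset n → Roles n → Bool
rowFits r [] [] = true
rowFits r (e ∷ N) (s ∷ L) = compatible r s e ∧ rowFits r N L

noIndependentNeighbour : ∀ {n} → Subset n → Roles n → Bool
noIndependentNeighbour [] [] = true
noIndependentNeighbour (e ∷ N) (s ∷ L) = not (isIndependent s ∧ e) ∧ noIndependentNeighbour N L

-- W marks the clique vertices that already have an independent neighbour among the vertices
-- processed so far; every clique vertex must end up with one.
vertexFits : ∀ {n} → Role → Bool → Subset n → Roles n → Bool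
vertexFits questioning w N L = rowFits questioning N L
vertexFits clique w N L = rowFits clique N L ∧ (w ∨ not (noIndependentNeighbour N L))
vertexFits independent w N L = rowFits independent N L

markWitnessed : ∀ {n} → Role → Vec Bool n → Subset n → Vec Bool n
markWitnessed independent W N = zipWith _∨_ W N
markWitnessed _ W N = W

fits : ∀ {n} → Graph n → Roles n → Vec Bool n → Bool
fits {zero} _ [] [] = true
fits {suc n} (N , G) (r ∷ L) (w ∷ W) = vertexFits r w N L ∧ fits G L (markWitnessed r W N)

-- The number of independent neighbourhoods, within m independent vertices, that a vertex of the
-- given role may have (nonempty for a clique vertex not yet witnessed).
choices : ℕ → Role → Bool → ℕ
choices m clique true = 2 ^ m
choices m clique false = 2 ^ m ∸ 1
choices m questioning _ = 1
choices m independent _ = 1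

witnessChoices : ∀ {n} → ℕ → Roles n → Vec Bool n → ℕ
witnessChoices m [] [] = 1
witnessChoices m (r ∷ L) (w ∷ W) = choices m r w * witnessChoices m L W

questioning-edge-determined : ∀ r → ∑ bools (λ e → 𝟙 (compatible questioning r e)) ≡ 1
questioning-edge-determined questioning = refl
questioning-edge-determined clique = refl
questioning-edge-determined independent = refl

∑-rowFits-questioning : ∀ {n} (L : Roles n) → ∑ (allSubsets n) (λ N → 𝟙 (rowFits questioning N L)) ≡ 1
∑-rowFits-questioning [] = refl
∑-rowFits-questioning {suc n} (r ∷ L) =
  trans (∑-allVecs-factor bools n _ (𝟙 ∘ compatible questioning r) (λ N → 𝟙 (rowFits questioning N L))
           (λ e N → 𝟙-∧ (compatible questioning r e) (rowFits questioning N L)))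
        (cong₂ _*_ (questioning-edge-determined r) (∑-rowFits-questioning L))

∑-rowFits-clique : ∀ {n} (L : Roles n) →
                   ∑ (allSubsets n) (λ N → 𝟙 (rowFits clique N L)) ≡ 2 ^ count independent L
∑-rowFits-clique [] = refl
∑-rowFits-clique {suc n} (r ∷ L) =
  trans (∑-allVecs-factor bools n _ (𝟙 ∘ compatible clique r) (λ N → 𝟙 (rowFits clique N L))
           (λ e N → 𝟙-∧ (compatible clique r e) (rowFits clique N L)))
        (trans (cong (∑ bools (λ e → 𝟙 (compatible clique r e)) *_) (∑-rowFits-clique L)) (edges r))
  where
  edges : ∀ r → ∑ bools (λ e → 𝟙 (compatible clique r e)) * 2 ^ count independent L ≡
                2 ^ count independent (r ∷ L)
  edges questioning = +-identityʳ _
  edges clique = +-identityʳ _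
  edges independent = refl

isolated-edge-determined : ∀ r → ∑ bools (λ e → 𝟙 (compatible clique r e ∧ not (isIndependent r ∧ e))) ≡ 1
isolated-edge-determined questioning = refl
isolated-edge-determined clique = refl
isolated-edge-determined independent = refl

∑-rowFits-clique-isolated : ∀ {n} (L : Roles n) →
  ∑ (allSubsets n) (λ N → 𝟙 (rowFits clique N L ∧ noIndependentNeighbour N L)) ≡ 1
∑-rowFits-clique-isolated [] = refl
∑-rowFits-clique-isolated {suc n} (r ∷ L) =
  trans (∑-allVecs-factor bools n _ (λ e → 𝟙 (compatible clique r e ∧ not (isIndependent r ∧ e)))
           (λ N → 𝟙 (rowFits clique N L ∧ noIndependentNeighbour N L))
           (λ e N → trans (cong 𝟙 (∧-interchange (compatible clique r e) (rowFits clique N L)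
                                                  (not (isIndependent r ∧ e)) (noIndependentNeighbour N L)))
                           (𝟙-∧ (compatible clique r e ∧ not (isIndependent r ∧ e)) _)))
        (cong₂ _*_ (isolated-edge-determined r) (∑-rowFits-clique-isolated L))

𝟙-split : ∀ a b → 𝟙 (a ∧ not b) + 𝟙 (a ∧ b) ≡ 𝟙 a
𝟙-split true true = refl
𝟙-split true false = refl
𝟙-split false b = refl

∑-rowFits-clique-witnessed : ∀ {n} (L : Roles n) w →
  ∑ (allSubsets n) (λ N → 𝟙 (rowFits clique N L ∧ (w ∨ not (noIndependentNeighbour N L)))) ≡
  choices (count independent L) clique w
∑-rowFits-clique-witnessed {n} L true =
  trans (∑-cong (allSubsets n) (λ N → cong 𝟙 (∧-identityʳ _))) (∑-rowFits-clique L)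
∑-rowFits-clique-witnessed {n} L false = begin
  witnessed-rows
    ≡⟨ m+n∸n≡m witnessed-rows 1 ⟨
  witnessed-rows + 1 ∸ 1
    ≡⟨ cong (λ k → witnessed-rows + k ∸ 1) (∑-rowFits-clique-isolated L) ⟨
  witnessed-rows + ∑ Ns (λ N → 𝟙 (fit N ∧ iso N)) ∸ 1
    ≡⟨ cong (_∸ 1) (∑-+ Ns _ _) ⟨
  ∑ Ns (λ N → 𝟙 (fit N ∧ not (iso N)) + 𝟙 (fit N ∧ iso N)) ∸ 1
    ≡⟨ cong (_∸ 1) (∑-cong Ns (λ N → 𝟙-split (fit N) (iso N))) ⟩
  ∑ Ns (λ N → 𝟙 (fit N)) ∸ 1
    ≡⟨ cong (_∸ 1) (∑-rowFits-clique L) ⟩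
  2 ^ count independent L ∸ 1
    ∎
  where
  Ns = allSubsets n
  witnessed-rows = ∑ Ns (λ N → 𝟙 (rowFits clique N L ∧ not (noIndependentNeighbour N L)))
  fit iso : Subset n → Bool
  fit N = rowFits clique N L
  iso N = noIndependentNeighbour N L

independent-edge-choices : ∀ m r w →
  ∑ bools (λ e → 𝟙 (compatible independent r e) * choices m r (w ∨ e)) ≡ choices (suc m) r w
independent-edge-choices m questioning w = refl
independent-edge-choices m independent w = refl
independent-edge-choices m clique true = cong₂ _+_ (+-identityʳ (2 ^ m)) (+-identityʳ (2 ^ m + 0))
independent-edge-choices m clique false = begin
  (2 ^ m + 0) + ((2 ^ m ∸ 1 + 0) + 0)
    ≡⟨ cong₂ _+_ (+-identityʳ _) (trans (+-identityʳ _) (+-identityʳ (2 ^ m ∸ 1))) ⟩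
  2 ^ m + (2 ^ m ∸ 1)
    ≡⟨ +-∸-assoc (2 ^ m) (m^n>0 2 m) ⟨
  2 ^ m + 2 ^ m ∸ 1
    ≡⟨ cong (λ k → 2 ^ m + k ∸ 1) (+-identityʳ (2 ^ m)) ⟨
  2 ^ suc m ∸ 1
    ∎

∑-rowFits-independent : ∀ {n} m (L : Roles n) W →
  ∑ (allSubsets n) (λ N → 𝟙 (rowFits independent N L) * witnessChoices m L (zipWith _∨_ W N)) ≡
  witnessChoices (suc m) L W
∑-rowFits-independent m [] [] = refl
∑-rowFits-independent {suc n} m (r ∷ L) (w ∷ W) =
  trans (∑-allVecs-factor bools n _ (λ e → 𝟙 (compatible independent r e) * choices m r (w ∨ e))
           (λ N → 𝟙 (rowFits independent N L) * witnessChoices m L (zipWith _∨_ W N))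
           (λ e N → trans (cong (_* (choices m r (w ∨ e) * witnessChoices m L (zipWith _∨_ W N)))
                                     (𝟙-∧ (compatible independent r e) (rowFits independent N L)))
                               (*-interchange (𝟙 (compatible independent r e)) (𝟙 (rowFits independent N L))
                                              (choices m r (w ∨ e)) (witnessChoices m L (zipWith _∨_ W N)))))
        (cong₂ _*_ (independent-edge-choices m r w) (∑-rowFits-independent m L W))

∑-vertexFits : ∀ {n} r w (L : Roles n) W →
  ∑ (allSubsets n) (λ N → 𝟙 (vertexFits r w N L) *
                         witnessChoices (count independent L) L (markWitnessed r W N)) ≡
  witnessChoices (count independent (r ∷ L)) (r ∷ L) (w ∷ W)
∑-vertexFits {n} questioning w L W =
  trans (∑-*ʳ (allSubsets n) (witnessChoices (count independent L) L W) _)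
        (cong (_* witnessChoices (count independent L) L W) (∑-rowFits-questioning L))
∑-vertexFits {n} clique w L W =
  trans (∑-*ʳ (allSubsets n) (witnessChoices (count independent L) L W) _)
        (cong (_* witnessChoices (count independent L) L W) (∑-rowFits-clique-witnessed L w))
∑-vertexFits independent w L W =
  trans (∑-rowFits-independent (count independent L) L W) (sym (+-identityʳ _))

∑-fits : ∀ n (L : Roles n) W →
         ∑ (allGraphs n) (λ G → 𝟙 (fits G L W)) ≡ witnessChoices (count independent L) L W
∑-fits zero [] [] = refl
∑-fits (suc n) (r ∷ L) (w ∷ W) = begin
  ∑ (allGraphs (suc n)) (λ G → 𝟙 (fits G (r ∷ L) (w ∷ W)))
    ≡⟨ ∑-allGraphs-suc n _ ⟩
  ∑ (allSubsets n) (λ N → ∑ (allGraphs n) (λ G → 𝟙 (vertexFits r w N L ∧ fits G L (markWitnessed r W N))))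
    ≡⟨ ∑-cong (allSubsets n) (λ N → trans (∑-cong (allGraphs n) (λ G → 𝟙-∧ (vertexFits r w N L) _))
                                            (∑-*ˡ (allGraphs n) (𝟙 (vertexFits r w N L)) _)) ⟩
  ∑ (allSubsets n) (λ N → 𝟙 (vertexFits r w N L) * ∑ (allGraphs n) (λ G → 𝟙 (fits G L (markWitnessed r W N))))
    ≡⟨ ∑-cong (allSubsets n) (λ N → cong (𝟙 (vertexFits r w N L) *_) (∑-fits n L _)) ⟩
  ∑ (allSubsets n) (λ N → 𝟙 (vertexFits r w N L) *
                          witnessChoices (count independent L) L (markWitnessed r W N))
    ≡⟨ ∑-vertexFits r w L W ⟩
  witnessChoices (count independent (r ∷ L)) (r ∷ L) (w ∷ W)
    ∎

unwitnessed : ∀ {n} → Vec Bool n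
unwitnessed = Vec.replicate _ false

witnessChoices-unwitnessed : ∀ {n} m (L : Roles n) →
                             witnessChoices m L unwitnessed ≡ (2 ^ m ∸ 1) ^ count clique L
witnessChoices-unwitnessed m [] = refl
witnessChoices-unwitnessed m (questioning ∷ L) = trans (+-identityʳ _) (witnessChoices-unwitnessed m L)
witnessChoices-unwitnessed m (clique ∷ L) = cong ((2 ^ m ∸ 1) *_) (witnessChoices-unwitnessed m L)
witnessChoices-unwitnessed m (independent ∷ L) = trans (+-identityʳ _) (witnessChoices-unwitnessed m L)

∨-true : ∀ a {b} → a ∨ b ≡ true → a ≡ true ⊎ b ≡ true
∨-true true _ = inj₁ refl
∨-true false b≡true = inj₂ b≡true

not-true : ∀ {b} → not b ≡ true → b ≡ false
not-true {false} _ = refl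

compatible-sym : ∀ r s e → compatible r s e ≡ compatible s r e
compatible-sym questioning questioning e = refl
compatible-sym questioning clique e = refl
compatible-sym questioning independent e = refl
compatible-sym clique questioning e = refl
compatible-sym clique clique e = refl
compatible-sym clique independent e = refl
compatible-sym independent questioning e = refl
compatible-sym independent clique e = refl
compatible-sym independent independent e = refl

Compatible : ∀ {n} → Graph n → Roles n → Set
Compatible G L = ∀ x y → x ≢ y → compatible (lookup L x) (lookup L y) (adj G x y) ≡ true

Witnessed : ∀ {n} → Graph n → Roles n → Vec Bool n → Set
Witnessed G L W = ∀ x → lookup L x ≡ clique →
  lookup W x ≡ true ⊎ ∃[ y ] (lookup L y ≡ independent × adj G x y ≡ true)

rowFits-sound : ∀ {n} r (N : Subset n) L → rowFits r N L ≡ true →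
                ∀ j → compatible r (lookup L j) (lookup N j) ≡ true
rowFits-sound r (e ∷ N) (s ∷ L) fit zero = ∧-conicalˡ _ _ fit
rowFits-sound r (e ∷ N) (s ∷ L) fit (suc j) = rowFits-sound r N L (∧-conicalʳ _ _ fit) j

rowFits-complete : ∀ {n} r (N : Subset n) L → (∀ j → compatible r (lookup L j) (lookup N j) ≡ true) →
                   rowFits r N L ≡ true
rowFits-complete r [] [] _ = refl
rowFits-complete r (e ∷ N) (s ∷ L) fit = cong₂ _∧_ (fit zero) (rowFits-complete r N L (fit ∘ suc))

IndependentNeighbourIn : ∀ {n} → Subset n → Roles n → Set
IndependentNeighbourIn N L = ∃[ j ] (lookup L j ≡ independent × lookup N j ≡ true)

noIndependentNeighbour-sound : ∀ {n} (N : Subset n) L → noIndependentNeighbour N L ≡ false →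
                               IndependentNeighbourIn N L
noIndependentNeighbour-sound [] [] ()
noIndependentNeighbour-sound (e ∷ N) (questioning ∷ L) none =
  Product.map suc id (noIndependentNeighbour-sound N L none)
noIndependentNeighbour-sound (e ∷ N) (clique ∷ L) none =
  Product.map suc id (noIndependentNeighbour-sound N L none)
noIndependentNeighbour-sound (true ∷ N) (independent ∷ L) _ = zero , refl , refl
noIndependentNeighbour-sound (false ∷ N) (independent ∷ L) none =
  Product.map suc id (noIndependentNeighbour-sound N L none)

noIndependentNeighbour-complete : ∀ {n} (N : Subset n) L j → lookup L j ≡ independent → lookup N j ≡ true →
                                  noIndependentNeighbour N L ≡ false
noIndependentNeighbour-complete (e ∷ N) (s ∷ L) zero refl refl = refl
noIndependentNeighbour-complete (e ∷ N) (s ∷ L) (suc j) Lj Nj =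
  trans (cong (not (isIndependent s ∧ e) ∧_) (noIndependentNeighbour-complete N L j Lj Nj)) (∧-zeroʳ _)

markWitnessed-sound : ∀ {n} r (W : Vec Bool n) N j → lookup (markWitnessed r W N) j ≡ true →
                      lookup W j ≡ true ⊎ (r ≡ independent × lookup N j ≡ true)
markWitnessed-sound questioning W N j marked = inj₁ marked
markWitnessed-sound clique W N j marked = inj₁ marked
markWitnessed-sound independent W N j marked =
  Sum.map₂ (refl ,_) (∨-true (lookup W j) (trans (sym (lookup-zipWith _∨_ j W N)) marked))

markWitnessed-keeps : ∀ {n} r (W : Vec Bool n) N j → lookup W j ≡ true → lookup (markWitnessed r W N) j ≡ true
markWitnessed-keeps questioning W N j Wj = Wj
markWitnessed-keeps clique W N j Wj = Wj
markWitnessed-keeps independent W N j Wj = trans (lookup-zipWith _∨_ j W N) (cong (_∨ lookup N j) Wj)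

markWitnessed-marks : ∀ {n} (W : Vec Bool n) N j → lookup N j ≡ true →
                      lookup (markWitnessed independent W N) j ≡ true
markWitnessed-marks W N j Nj =
  trans (lookup-zipWith _∨_ j W N) (trans (cong (lookup W j ∨_) Nj) (∨-zeroʳ (lookup W j)))

vertexFits-sound : ∀ {n} r w (N : Subset n) L → vertexFits r w N L ≡ true →
  (∀ j → compatible r (lookup L j) (lookup N j) ≡ true) ×
  (r ≡ clique → w ≡ true ⊎ IndependentNeighbourIn N L)
vertexFits-sound questioning w N L fit = rowFits-sound questioning N L fit , λ ()
vertexFits-sound independent w N L fit = rowFits-sound independent N L fit , λ ()
vertexFits-sound clique w N L fit =
  rowFits-sound clique N L (∧-conicalˡ _ _ fit) ,
  λ _ → Sum.map₂ (noIndependentNeighbour-sound N L ∘ not-true) (∨-true w (∧-conicalʳ _ _ fit))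

vertexFits-complete : ∀ {n} r w (N : Subset n) L →
  (∀ j → compatible r (lookup L j) (lookup N j) ≡ true) →
  (r ≡ clique → w ≡ true ⊎ IndependentNeighbourIn N L) →
  vertexFits r w N L ≡ true
vertexFits-complete questioning w N L row _ = rowFits-complete questioning N L row
vertexFits-complete independent w N L row _ = rowFits-complete independent N L row
vertexFits-complete clique w N L row witness with witness refl
... | inj₁ w≡true = cong₂ _∧_ (rowFits-complete clique N L row) (cong (_∨ _) w≡true)
... | inj₂ (j , Lj , Nj) = cong₂ _∧_ (rowFits-complete clique N L row)
  (trans (cong (λ b → w ∨ not b) (noIndependentNeighbour-complete N L j Lj Nj)) (∨-zeroʳ w))

fits-sound : ∀ {n} (G : Graph n) L W → fits G L W ≡ true → Compatible G L × Witnessed G L W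
fits-sound {zero} _ [] [] _ = (λ ()) , (λ ())
fits-sound {suc n} (N , G) (r ∷ L) (w ∷ W) fit = compat , witnessed
  where
  first = vertexFits-sound r w N L (∧-conicalˡ _ _ fit)
  rest = fits-sound G L (markWitnessed r W N) (∧-conicalʳ _ _ fit)
  compat : Compatible (N , G) (r ∷ L)
  compat zero zero 0≢0 = ⊥-elim (0≢0 refl)
  compat zero (suc j) _ = proj₁ first j
  compat (suc i) zero _ = trans (compatible-sym (lookup L i) r _) (proj₁ first i)
  compat (suc i) (suc j) i≢j = proj₁ rest i j (i≢j ∘ cong suc)
  witnessed : Witnessed (N , G) (r ∷ L) (w ∷ W)
  witnessed zero r≡clique = Sum.map₂ (Product.map suc id) (proj₂ first r≡clique)
  witnessed (suc i) Li with proj₂ rest i Li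
  ... | inj₂ (y , Ly , i~y) = inj₂ (suc y , Ly , i~y)
  ... | inj₁ marked =
    Sum.map₂ (λ (r≡independent , Ni) → zero , r≡independent , Ni) (markWitnessed-sound r W N i marked)

fits-complete : ∀ {n} (G : Graph n) L W → Compatible G L → Witnessed G L W → fits G L W ≡ true
fits-complete {zero} _ [] [] _ _ = refl
fits-complete {suc n} (N , G) (r ∷ L) (w ∷ W) compat witnessed =
  cong₂ _∧_ (vertexFits-complete r w N L (λ j → compat zero (suc j) (λ ())) first-witnessed)
            (fits-complete G L (markWitnessed r W N) rest-compat rest-witnessed)
  where
  rest-compat : Compatible G L
  rest-compat i j i≢j = compat (suc i) (suc j) (i≢j ∘ suc-injective)
  first-witnessed : r ≡ clique → w ≡ true ⊎ IndependentNeighbourIn N L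
  first-witnessed r≡clique with witnessed zero r≡clique
  ... | inj₁ w≡true = inj₁ w≡true
  ... | inj₂ (zero , r≡independent , _) with () ← trans (sym r≡clique) r≡independent
  ... | inj₂ (suc j , Lj , Nj) = inj₂ (j , Lj , Nj)
  rest-witnessed : Witnessed G L (markWitnessed r W N)
  rest-witnessed i Li with witnessed (suc i) Li
  ... | inj₁ Wi = inj₁ (markWitnessed-keeps r W N i Wi)
  ... | inj₂ (zero , refl , Ni) = inj₁ (markWitnessed-marks W N i Ni)
  ... | inj₂ (suc y , Ly , i~y) = inj₂ (y , Ly , i~y)

-- Split partitions and roles

SplitPartition : ∀ {n} → Graph n → Subset n → Set
SplitPartition G = IsSplitPartition (toAdjMat G)

module _ {n} (G : Graph n) {K : Subset n} (split : SplitPartition G K) where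

  clique-part-adj : ∀ {x y} → x ∈ K → y ∈ K → x ≢ y → adj G x y ≡ true
  clique-part-adj {x} {y} x∈K y∈K x≢y = Adj⇒adj G x y (proj₁ split x y x∈K y∈K x≢y)

  independent-part-nonadj : ∀ {x y} → x ∉ K → y ∉ K → adj G x y ≡ false
  independent-part-nonadj {x} {y} x∉K y∉K = ¬-not (proj₂ split x y x∉K y∉K ∘ adj⇒Adj G x y)

mkSplitPartition : ∀ {n} (G : Graph n) K →
  (∀ x y → x ∈ K → y ∈ K → x ≢ y → adj G x y ≡ true) →
  (∀ x y → x ∉ K → y ∉ K → adj G x y ≡ false) →
  SplitPartition G K
mkSplitPartition G K in-clique in-independent =
  (λ x y x∈K y∈K x≢y → adj⇒Adj G x y (in-clique x y x∈K y∈K x≢y)) ,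
  (λ x y x∉K y∉K x~y → not-¬ (Adj⇒adj G x y x~y) (in-independent x y x∉K y∉K))

InEveryClique : ∀ {n} → Graph n → Fin n → Set
InEveryClique G x = ∀ {K} → SplitPartition G K → x ∈ K

InNoClique : ∀ {n} → Graph n → Fin n → Set
InNoClique G x = ∀ {K} → SplitPartition G K → x ∉ K

InQ-adj-InEveryClique : ∀ {n} (G : Graph n) {x y} → InQ (toAdjMat G) x → InEveryClique G y → x ≢ y →
                        adj G x y ≡ true
InQ-adj-InEveryClique G ((K , split , x∈K) , _) y∈ x≢y = clique-part-adj G split x∈K (y∈ split) x≢y

InQ-nonadj-InNoClique : ∀ {n} (G : Graph n) {x y} → InQ (toAdjMat G) x → InNoClique G y → adj G x y ≡ false
InQ-nonadj-InNoClique G (_ , (K , split , x∉K)) y∉ = independent-part-nonadj G split x∉K (y∉ split)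

∈-tabulate⁻ : ∀ {n} (f : Fin n → Bool) {x} → x ∈ Vec.tabulate f → f x ≡ true
∈-tabulate⁻ f {x} x∈ = trans (sym (lookup∘tabulate f x)) ([]=⇒lookup x∈)

∈-tabulate⁺ : ∀ {n} (f : Fin n → Bool) {x} → f x ≡ true → x ∈ Vec.tabulate f
∈-tabulate⁺ f {x} fx = lookup⇒[]= x _ (trans (lookup∘tabulate f x) fx)

∉-tabulate⁻ : ∀ {n} (f : Fin n → Bool) {x} → x ∉ Vec.tabulate f → f x ≡ false
∉-tabulate⁻ f x∉ = ¬-not (x∉ ∘ ∈-tabulate⁺ f)

module CompatibleRoles {n} {G : Graph n} {L : Roles n} (compat : Compatible G L) where

  nonIndependent-adj : ∀ x y → x ≢ y →
                       isIndependent (lookup L x) ≡ false → isIndependent (lookup L y) ≡ false → adj G x y ≡ true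
  nonIndependent-adj x y x≢y = table (lookup L x) (lookup L y) (compat x y x≢y)
    where
    table : ∀ r s {e} → compatible r s e ≡ true → isIndependent r ≡ false → isIndependent s ≡ false → e ≡ true
    table questioning questioning ok _ _ = ok
    table questioning clique ok _ _ = ok
    table clique questioning ok _ _ = ok
    table clique clique ok _ _ = ok

  independent-nonadj : ∀ x y → lookup L x ≢ clique → lookup L y ≡ independent → adj G x y ≡ false
  independent-nonadj x y Lx≢clique Ly with x ≟ᶠ y
  ... | yes refl = adj-irrefl G x
  ... | no x≢y =
    table (lookup L x) Lx≢clique (subst (λ s → compatible (lookup L x) s _ ≡ true) Ly (compat x y x≢y))
    where
    table : ∀ r {e} → r ≢ clique → compatible r independent e ≡ true → e ≡ false
    table questioning _ ok = not-true ok
    table clique r≢clique _ = ⊥-elim (r≢clique refl)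
    table independent _ ok = not-true ok

  nonIndependent : Subset n
  nonIndependent = Vec.tabulate (λ z → not (isIndependent (lookup L z)))

  nonIndependent-∋ : ∀ {x} → isIndependent (lookup L x) ≡ false → x ∈ nonIndependent
  nonIndependent-∋ Lx = ∈-tabulate⁺ _ (cong not Lx)

  nonIndependent-split : SplitPartition G nonIndependent
  nonIndependent-split = mkSplitPartition G nonIndependent
    (λ x y x∈ y∈ x≢y → nonIndependent-adj x y x≢y (inside x∈) (inside y∈))
    (λ x y x∉ y∉ → independent-nonadj x y (subst (_≢ clique) (sym (outside x∉)) λ ()) (outside y∉))
    where
    inside : ∀ {z} → z ∈ nonIndependent → isIndependent (lookup L z) ≡ false
    inside z∈ = not-true (∈-tabulate⁻ _ z∈)
    outside : ∀ {z} → z ∉ nonIndependent → lookup L z ≡ independent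
    outside z∉ = isIndependent-true (not-injective (∉-tabulate⁻ _ z∉))

  -- A non-independent vertex without independent neighbours can be moved to the independent part.
  module _ (x : Fin n) (isolated : ∀ z → lookup L z ≡ independent → adj G x z ≡ false) where

    nonIndependentExcept : Subset n
    nonIndependentExcept = Vec.tabulate (λ z → not (isIndependent (lookup L z)) ∧ not (does (z ≟ᶠ x)))

    ∈nonIndependentExcept : ∀ {z} → z ∈ nonIndependentExcept → isIndependent (lookup L z) ≡ false × z ≢ x
    ∈nonIndependentExcept {z} z∈ with isIndependent (lookup L z) | z ≟ᶠ x | ∈-tabulate⁻ _ z∈
    ... | false | no z≢x | _ = refl , z≢x

    ∉nonIndependentExcept : ∀ {z} → z ∉ nonIndependentExcept → lookup L z ≡ independent ⊎ z ≡ x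
    ∉nonIndependentExcept {z} z∉ with isIndependent (lookup L z) in Lz | z ≟ᶠ x | ∉-tabulate⁻ _ z∉
    ... | true | _ | _ = inj₁ (isIndependent-true Lz)
    ... | false | yes z≡x | _ = inj₂ z≡x

    x∉nonIndependentExcept : x ∉ nonIndependentExcept
    x∉nonIndependentExcept x∈ = proj₂ (∈nonIndependentExcept x∈) refl

    nonIndependentExcept-split : SplitPartition G nonIndependentExcept
    nonIndependentExcept-split = mkSplitPartition G nonIndependentExcept
      (λ a b a∈ b∈ a≢b →
        nonIndependent-adj a b a≢b (proj₁ (∈nonIndependentExcept a∈)) (proj₁ (∈nonIndependentExcept b∈)))
      (λ a b a∉ b∉ → outside (∉nonIndependentExcept a∉) (∉nonIndependentExcept b∉))
      where
      outside : ∀ {a b} → lookup L a ≡ independent ⊎ a ≡ x → lookup L b ≡ independent ⊎ b ≡ x →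
                adj G a b ≡ false
      outside {a} {b} (inj₁ La) (inj₁ Lb) = independent-nonadj a b (subst (_≢ clique) (sym La) λ ()) Lb
      outside {a} (inj₁ La) (inj₂ refl) = trans (adj-sym G a x) (isolated a La)
      outside {b = b} (inj₂ refl) (inj₁ Lb) = isolated b Lb
      outside (inj₂ refl) (inj₂ refl) = adj-irrefl G x

  questioning⇒InQ : ∀ x → lookup L x ≡ questioning → InQ (toAdjMat G) x
  questioning⇒InQ x Lx =
    (nonIndependent , nonIndependent-split , nonIndependent-∋ (cong isIndependent Lx)) ,
    (nonIndependentExcept x isolated , nonIndependentExcept-split x isolated , x∉nonIndependentExcept x isolated)
    where
    isolated : ∀ z → lookup L z ≡ independent → adj G x z ≡ false
    isolated z = independent-nonadj x z (subst (_≢ clique) (sym Lx) λ ())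

-- The roles of the vertices of G when Q is a clique with at least two vertices.
record SplitRoles {n} (G : Graph n) (L : Roles n) : Set where
  constructor splitRoles
  field
    compat : Compatible G L
    witnessed : Witnessed G L unwitnessed
    2≤#questioning : 2 ≤ count questioning L

module SplitRolesProperties {n} {G : Graph n} {L : Roles n} (roles : SplitRoles G L) where

  open SplitRoles roles

  private
    questioning-pair = 2≤count⇒questioning-pair L 2≤#questioning

  u v : Fin n
  u = proj₁ questioning-pair
  v = proj₁ (proj₂ questioning-pair)

  u≢v : u ≢ v
  u≢v = proj₁ (proj₂ (proj₂ questioning-pair))

  Lu : lookup L u ≡ questioning
  Lu = proj₁ (proj₂ (proj₂ (proj₂ questioning-pair)))

  Lv : lookup L v ≡ questioning
  Lv = proj₂ (proj₂ (proj₂ (proj₂ questioning-pair)))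

  open CompatibleRoles {L = L} compat public

  u~v : adj G u v ≡ true
  u~v = nonIndependent-adj u v u≢v (cong isIndependent Lu) (cong isIndependent Lv)

  clique-part-meets-Q : ∀ {K} → SplitPartition G K → ∃[ a ] (lookup L a ≡ questioning × a ∈ K)
  clique-part-meets-Q {K} split with u ∈? K | v ∈? K
  ... | yes u∈K | _ = u , Lu , u∈K
  ... | no _ | yes v∈K = v , Lv , v∈K
  ... | no u∉K | no v∉K = ⊥-elim (not-¬ u~v (independent-part-nonadj G split u∉K v∉K))

  independent⇒outside : ∀ x → lookup L x ≡ independent → InNoClique G x
  independent⇒outside x Lx split x∈K with clique-part-meets-Q split
  ... | a , La , a∈K with a ≟ᶠ x
  ...   | yes refl with () ← trans (sym La) Lx
  ...   | no a≢x = not-¬ (clique-part-adj G split a∈K x∈K a≢x)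
                         (independent-nonadj a x (subst (_≢ clique) (sym La) λ ()) Lx)

  clique⇒inside : ∀ x → lookup L x ≡ clique → InEveryClique G x
  clique⇒inside x Lx {K} split with x ∈? K
  ... | yes x∈K = x∈K
  ... | no x∉K with witnessed x Lx
  ...   | inj₁ marked = ⊥-elim (not-¬ marked (lookup-replicate x false))
  ...   | inj₂ (y , Ly , x~y) with y ∈? K
  ...     | yes y∈K = ⊥-elim (independent⇒outside y Ly split y∈K)
  ...     | no y∉K = ⊥-elim (not-¬ x~y (independent-part-nonadj G split x∉K y∉K))

  InQ⇒questioning : ∀ x → InQ (toAdjMat G) x → lookup L x ≡ questioning
  InQ⇒questioning x ((K₁ , split₁ , x∈K₁) , (K₂ , split₂ , x∉K₂)) with lookup L x in Lx
  ... | questioning = refl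
  ... | clique = ⊥-elim (x∉K₂ (clique⇒inside x Lx split₂))
  ... | independent = ⊥-elim (independent⇒outside x Lx split₁ x∈K₁)

  counted : Counted (toAdjMat G)
  counted = toAdjMat-isGraph G , (nonIndependent , nonIndependent-split) ,
            (u , v , u≢v , questioning⇒InQ u Lu , questioning⇒InQ v Lv)

SplitRoles-unique : ∀ {n} {G : Graph n} {L L′ : Roles n} → SplitRoles G L → SplitRoles G L′ → L ≡ L′
SplitRoles-unique {G = G} {L} {L′} roles roles′ = vec-ext L L′ same-role
  where
  module R = SplitRolesProperties roles
  module R′ = SplitRolesProperties roles′
  same-role : ∀ x → lookup L x ≡ lookup L′ x
  same-role x with lookup L x in Lx | lookup L′ x in L′x
  ... | questioning | _ = sym (trans (sym L′x) (R′.InQ⇒questioning x (R.questioning⇒InQ x Lx)))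
  ... | clique | questioning = trans (sym Lx) (R.InQ⇒questioning x (R′.questioning⇒InQ x L′x))
  ... | independent | questioning = trans (sym Lx) (R.InQ⇒questioning x (R′.questioning⇒InQ x L′x))
  ... | clique | clique = refl
  ... | independent | independent = refl
  ... | clique | independent =
    ⊥-elim (R′.independent⇒outside x L′x R.nonIndependent-split (R.nonIndependent-∋ (cong isIndependent Lx)))
  ... | independent | clique =
    ⊥-elim (R.independent⇒outside x Lx R′.nonIndependent-split (R′.nonIndependent-∋ (cong isIndependent L′x)))

-- Take a split partition with y independent: its clique contains x, and also z unless z is
-- independent there too; then a split partition with z in the clique settles it.
InQ-neighbour : ∀ {n} (G : Graph n) {x y z} → InQ (toAdjMat G) y → InQ (toAdjMat G) z → z ≢ x → z ≢ y →
                adj G x y ≡ true → adj G x z ≡ true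
InQ-neighbour G {x} {y} {z} (_ , Ky , split-y , y∉Ky) ((Kz , split-z , z∈Kz) , _) z≢x z≢y x~y with x ∈? Ky
... | no x∉Ky = ⊥-elim (not-¬ x~y (independent-part-nonadj G split-y x∉Ky y∉Ky))
... | yes x∈Ky with z ∈? Ky
...   | yes z∈Ky = clique-part-adj G split-y x∈Ky z∈Ky (z≢x ∘ sym)
...   | no z∉Ky with x ∈? Kz
...     | yes x∈Kz = clique-part-adj G split-z x∈Kz z∈Kz (z≢x ∘ sym)
...     | no x∉Kz with y ∈? Kz
...       | yes y∈Kz = ⊥-elim (not-¬ (clique-part-adj G split-z y∈Kz z∈Kz (z≢y ∘ sym))
                                     (independent-part-nonadj G split-y y∉Ky z∉Ky))
...       | no y∉Kz = ⊥-elim (not-¬ x~y (independent-part-nonadj G split-z x∉Kz y∉Kz))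

module FromQuestioningEdge {n} (G : Graph n) {K₀} (split₀ : SplitPartition G K₀)
                           {u v} (u≢v : u ≢ v) (Qu : InQ (toAdjMat G) u) (Qv : InQ (toAdjMat G) v)
                           (u~v : adj G u v ≡ true) where

  u-adj : ∀ {w} → InQ (toAdjMat G) w → w ≢ u → adj G u w ≡ true
  u-adj {w} Qw w≢u with w ≟ᶠ v
  ... | yes refl = u~v
  ... | no w≢v = InQ-neighbour G Qv Qw w≢u w≢v u~v

  Q-clique : ∀ {a b} → InQ (toAdjMat G) a → InQ (toAdjMat G) b → a ≢ b → adj G a b ≡ true
  Q-clique {a} {b} Qa Qb a≢b with a ≟ᶠ u | b ≟ᶠ u
  ... | yes refl | _ = u-adj Qb (a≢b ∘ sym)
  ... | no a≢u | yes refl = trans (adj-sym G a u) (u-adj Qa a≢u)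
  ... | no a≢u | no b≢u = InQ-neighbour G Qu Qb (a≢b ∘ sym) b≢u (trans (adj-sym G a u) (u-adj Qa a≢u))

  role : Fin n → Role
  role x with inQ? (toAdjMat G) x | x ∈? K₀
  ... | yes _ | _ = questioning
  ... | no _ | yes _ = clique
  ... | no _ | no _ = independent

  role-questioning : ∀ x → role x ≡ questioning → InQ (toAdjMat G) x
  role-questioning x rx with inQ? (toAdjMat G) x | x ∈? K₀
  role-questioning x _ | yes Qx | _ = Qx
  role-questioning x () | no _ | yes _
  role-questioning x () | no _ | no _

  InQ⇒role : ∀ x → InQ (toAdjMat G) x → role x ≡ questioning
  InQ⇒role x Qx with inQ? (toAdjMat G) x | x ∈? K₀
  ... | yes _ | _ = refl
  ... | no ¬Qx | _ = ⊥-elim (¬Qx Qx)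

  role-clique : ∀ x → role x ≡ clique → InEveryClique G x
  role-clique x rx {K} split with inQ? (toAdjMat G) x | x ∈? K₀ | x ∈? K
  role-clique x () split | yes _ | _ | _
  role-clique x rx split | no _ | yes _ | yes x∈K = x∈K
  role-clique x rx split | no ¬Qx | yes x∈K₀ | no x∉K =
    ⊥-elim (¬Qx ((K₀ , split₀ , x∈K₀) , (_ , split , x∉K)))
  role-clique x () split | no _ | no _ | _

  role-independent : ∀ x → role x ≡ independent → InNoClique G x
  role-independent x rx {K} split x∈K with inQ? (toAdjMat G) x | x ∈? K₀
  role-independent x () split x∈K | yes _ | _
  role-independent x () split x∈K | no _ | yes _
  role-independent x rx split x∈K | no ¬Qx | no x∉K₀ = ¬Qx ((_ , split , x∈K) , (K₀ , split₀ , x∉K₀))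

  role-compatible : ∀ x y → x ≢ y → compatible (role x) (role y) (adj G x y) ≡ true
  role-compatible x y x≢y with role x in rx | role y in ry
  ... | questioning | questioning = Q-clique (role-questioning x rx) (role-questioning y ry) x≢y
  ... | questioning | clique = InQ-adj-InEveryClique G (role-questioning x rx) (role-clique y ry) x≢y
  ... | clique | questioning =
    trans (adj-sym G x y) (InQ-adj-InEveryClique G (role-questioning y ry) (role-clique x rx) (x≢y ∘ sym))
  ... | questioning | independent =
    cong not (InQ-nonadj-InNoClique G (role-questioning x rx) (role-independent y ry))
  ... | independent | questioning =
    cong not (trans (adj-sym G x y) (InQ-nonadj-InNoClique G (role-questioning y ry) (role-independent x rx)))
  ... | clique | clique = clique-part-adj G split₀ (role-clique x rx split₀) (role-clique y ry split₀) x≢y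
  ... | clique | independent = refl
  ... | independent | clique = refl
  ... | independent | independent =
    cong not (independent-part-nonadj G split₀ (role-independent x rx split₀) (role-independent y ry split₀))

  L : Roles n
  L = Vec.tabulate role

  lookup-L : ∀ x → lookup L x ≡ role x
  lookup-L = lookup∘tabulate role

  compat : Compatible G L
  compat x y x≢y rewrite lookup-L x | lookup-L y = role-compatible x y x≢y

  open CompatibleRoles {L = L} compat

  witnessed : Witnessed G L unwitnessed
  witnessed x Lx with any? (λ y → (lookup L y ≟ʳ independent) ×-dec (adj G x y ≟ᵇ true))
  ... | yes witness = inj₂ witness
  ... | no no-witness =
    ⊥-elim (x∉nonIndependentExcept x isolated
             (role-clique x (trans (sym (lookup-L x)) Lx) (nonIndependentExcept-split x isolated)))
    where
    isolated : ∀ z → lookup L z ≡ independent → adj G x z ≡ false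
    isolated z Lz = ¬-not (λ x~z → no-witness (z , Lz , x~z))

  roles : SplitRoles G L
  roles = record { compat = compat ; witnessed = witnessed ; 2≤#questioning =
    questioning⇒2≤count L u v u≢v (trans (lookup-L u) (InQ⇒role u Qu)) (trans (lookup-L v) (InQ⇒role v Qv)) }

complement-split : ∀ {n} (G : Graph n) {K} → SplitPartition G K → SplitPartition (complement G) (∁ K)
complement-split G {K} split = mkSplitPartition (complement G) (∁ K)
  (λ x y x∈ y∈ x≢y → trans (adj-complement G x y x≢y)
                           (cong not (independent-part-nonadj G split (x∈∁p⇒x∉p x∈) (x∈∁p⇒x∉p y∈))))
  (λ x y x∉ y∉ → nonadj x y (x∉∁p⇒x∈p x∉) (x∉∁p⇒x∈p y∉))
  where
  nonadj : ∀ x y → x ∈ K → y ∈ K → adj (complement G) x y ≡ false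
  nonadj x y x∈K y∈K with x ≟ᶠ y
  ... | yes refl = adj-irrefl (complement G) x
  ... | no x≢y = trans (adj-complement G x y x≢y) (cong not (clique-part-adj G split x∈K y∈K x≢y))

complement-InQ : ∀ {n} (G : Graph n) {x} → InQ (toAdjMat G) x → InQ (toAdjMat (complement G)) x
complement-InQ G ((K₁ , split₁ , x∈K₁) , (K₂ , split₂ , x∉K₂)) =
  (∁ K₂ , complement-split G split₂ , x∉p⇒x∈∁p x∉K₂) , (∁ K₁ , complement-split G split₁ , x∈p⇒x∉∁p x∈K₁)

complement-InQ⁻ : ∀ {n} (G : Graph n) {x} → InQ (toAdjMat (complement G)) x → InQ (toAdjMat G) x
complement-InQ⁻ G Qx =
  subst (λ H → InQ (toAdjMat H) _) (complement-involutive G) (complement-InQ (complement G) Qx)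

complement-counted⁻ : ∀ {n} (G : Graph n) → Counted (toAdjMat (complement G)) → Counted (toAdjMat G)
complement-counted⁻ G (_ , (K , split) , (u , v , u≢v , Qu , Qv)) =
  toAdjMat-isGraph G ,
  (∁ K , subst (λ H → SplitPartition H (∁ K)) (complement-involutive G)
                (complement-split (complement G) split)) ,
  (u , v , u≢v , complement-InQ⁻ G Qu , complement-InQ⁻ G Qv)

-- G and its complement have the same Q, and an edge of G inside Q is a non-edge of the complement.
SplitRoles-exclusive : ∀ {n} {G : Graph n} {L L′} → SplitRoles G L → ¬ SplitRoles (complement G) L′
SplitRoles-exclusive {G = G} {L} {L′} roles roles′ =
  not-¬ (R′.nonIndependent-adj R.u R.v R.u≢v (nonIndependent R.u R.Lu) (nonIndependent R.v R.Lv))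
        (trans (adj-complement G R.u R.v R.u≢v) (cong not R.u~v))
  where
  module R = SplitRolesProperties roles
  module R′ = SplitRolesProperties roles′
  nonIndependent : ∀ x → lookup L x ≡ questioning → isIndependent (lookup L′ x) ≡ false
  nonIndependent x Lx = cong isIndependent (R′.InQ⇒questioning x (complement-InQ G (R.questioning⇒InQ x Lx)))

splitRolesᵇ : ∀ {n} → Graph n → Roles n → Bool
splitRolesᵇ G L = fits G L unwitnessed ∧ (2 ≤ᵇ count questioning L)

splitRolesᵇ-sound : ∀ {n} (G : Graph n) L → splitRolesᵇ G L ≡ true → SplitRoles G L
splitRolesᵇ-sound G L ok =
  let compat , witnessed = fits-sound G L unwitnessed (∧-conicalˡ _ _ ok)
  in splitRoles compat witnessed (≤ᵇ⇒≤ 2 _ (Equivalence.from T-≡ (∧-conicalʳ _ _ ok)))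

splitRolesᵇ-complete : ∀ {n} (G : Graph n) L → SplitRoles G L → splitRolesᵇ G L ≡ true
splitRolesᵇ-complete G L (splitRoles compat witnessed 2≤) =
  cong₂ _∧_ (fits-complete G L unwitnessed compat witnessed) (Equivalence.to T-≡ (≤⇒≤ᵇ 2≤))

#SplitRoles : ∀ {n} → Graph n → ℕ
#SplitRoles {n} G = ∑ (allVecs allRoles n) (λ L → 𝟙 (splitRolesᵇ G L))

𝟙-splitRolesᵇ≡0 : ∀ {n} (G : Graph n) L → ¬ SplitRoles G L → 𝟙 (splitRolesᵇ G L) ≡ 0
𝟙-splitRolesᵇ≡0 G L ¬roles = cong 𝟙 (¬-not (¬roles ∘ splitRolesᵇ-sound G L))

#SplitRoles≡1 : ∀ {n} (G : Graph n) {L₀} → SplitRoles G L₀ → #SplitRoles G ≡ 1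
#SplitRoles≡1 {n} G {L₀} roles₀ =
  trans (allVecs-enumerates allRoles allRoles-enumerate n L₀ _
           (λ L L≢L₀ → 𝟙-splitRolesᵇ≡0 G L (λ roles → L≢L₀ (SplitRoles-unique roles roles₀))))
        (cong 𝟙 (splitRolesᵇ-complete G L₀ roles₀))

#SplitRoles≡0 : ∀ {n} (G : Graph n) → (∀ L → ¬ SplitRoles G L) → #SplitRoles G ≡ 0
#SplitRoles≡0 {n} G none = ∑-vanishes (allVecs allRoles n) _ (λ L → 𝟙-splitRolesᵇ≡0 G L (none L))

#SplitRoles± : ∀ {n} → Graph n → ℕ
#SplitRoles± G = #SplitRoles G + #SplitRoles (complement G)

counted⇒#SplitRoles±≡1 : ∀ {n} (G : Graph n) → Counted (toAdjMat G) → #SplitRoles± G ≡ 1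
counted⇒#SplitRoles±≡1 G (_ , (K₀ , split₀) , (u , v , u≢v , Qu , Qv)) with adj G u v in u~v
... | true = cong₂ _+_ (#SplitRoles≡1 G F.roles)
                       (#SplitRoles≡0 (complement G) (λ L → SplitRoles-exclusive F.roles))
  where module F = FromQuestioningEdge G split₀ u≢v Qu Qv u~v
... | false = cong₂ _+_ (#SplitRoles≡0 G (λ L roles → SplitRoles-exclusive roles F.roles))
                        (#SplitRoles≡1 (complement G) F.roles)
  where module F = FromQuestioningEdge (complement G) (complement-split G split₀) u≢v
                                       (complement-InQ G Qu) (complement-InQ G Qv)
                                       (trans (adj-complement G u v u≢v) (cong not u~v))

¬counted⇒#SplitRoles±≡0 : ∀ {n} (G : Graph n) → ¬ Counted (toAdjMat G) → #SplitRoles± G ≡ 0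
¬counted⇒#SplitRoles±≡0 G ¬counted = cong₂ _+_
  (#SplitRoles≡0 G (λ L → ¬counted ∘ SplitRolesProperties.counted))
  (#SplitRoles≡0 (complement G) (λ L → ¬counted ∘ complement-counted⁻ G ∘ SplitRolesProperties.counted))

𝟙-does : ∀ {p} {P : Set p} (P? : Dec P) {k} → (P → k ≡ 1) → (¬ P → k ≡ 0) → 𝟙 (does P?) ≡ k
𝟙-does (yes p) is-one _ = sym (is-one p)
𝟙-does (no ¬p) _ is-zero = sym (is-zero ¬p)

-- The summand of the formula, with the range q ≥ 2 turned into a factor.
splitRolesWeight : ℕ → ℕ → ℕ → ℕ
splitRolesWeight n q c = 𝟙 (2 ≤ᵇ q) * (2 ^ (n ∸ c ∸ q) ∸ 1) ^ c

∑-#SplitRoles : ∀ n → ∑ (allGraphs n) #SplitRoles ≡ trinomialSum n (splitRolesWeight n)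
∑-#SplitRoles n = begin
  ∑ Gs (λ G → ∑ Ls (λ L → 𝟙 (splitRolesᵇ G L)))
    ≡⟨ ∑-comm Gs Ls _ ⟩
  ∑ Ls (λ L → ∑ Gs (λ G → 𝟙 (splitRolesᵇ G L)))
    ≡⟨ ∑-cong Ls (λ L → ∑-cong Gs (λ G → 𝟙-∧ (fits G L unwitnessed) _)) ⟩
  ∑ Ls (λ L → ∑ Gs (λ G → 𝟙 (fits G L unwitnessed) * 𝟙 (2 ≤ᵇ count questioning L)))
    ≡⟨ ∑-cong Ls (λ L → ∑-*ʳ Gs (𝟙 (2 ≤ᵇ count questioning L)) _) ⟩
  ∑ Ls (λ L → ∑ Gs (λ G → 𝟙 (fits G L unwitnessed)) * 𝟙 (2 ≤ᵇ count questioning L))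
    ≡⟨ ∑-cong Ls (λ L → cong (_* 𝟙 (2 ≤ᵇ count questioning L))
                             (trans (∑-fits n L unwitnessed) (graphs-per-roles L))) ⟩
  ∑ Ls (λ L → (2 ^ (n ∸ count clique L ∸ count questioning L) ∸ 1) ^ count clique L *
              𝟙 (2 ≤ᵇ count questioning L))
    ≡⟨ ∑-cong Ls (λ L → *-comm _ (𝟙 (2 ≤ᵇ count questioning L))) ⟩
  ∑ Ls (λ L → splitRolesWeight n (count questioning L) (count clique L))
    ≡⟨ ∑-allRoles-trinomial n (splitRolesWeight n) ⟩
  trinomialSum n (splitRolesWeight n)
    ∎
  where
  Gs = allGraphs n
  Ls = allVecs allRoles n
  graphs-per-roles : ∀ L → witnessChoices (count independent L) L unwitnessed ≡
                           (2 ^ (n ∸ count clique L ∸ count questioning L) ∸ 1) ^ count clique L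
  graphs-per-roles L = trans (witnessChoices-unwitnessed (count independent L) L)
                             (cong (λ m → (2 ^ m ∸ 1) ^ count clique L) (count-independent L))

formula≡trinomialSum : ∀ n → formula n ≡ 2 * trinomialSum n (splitRolesWeight n)
formula≡trinomialSum n = cong (2 *_) (begin
  ∑ (upTo (n ∸ 1)) (λ i → ∑ (upTo (suc (n ∸ (2 + i)))) (term (2 + i)))
    ≡⟨ ∑-upTo (n ∸ 1) _ ⟩
  ∑< (n ∸ 1) (λ i → ∑ (upTo (suc (n ∸ (2 + i)))) (term (2 + i)))
    ≡⟨ ∑<-cong (n ∸ 1) (λ i _ → row (2 + i) refl) ⟩
  ∑< (n ∸ 1) (λ i → h (2 + i))
    ≡⟨ ∑<-from-2 n h (vanishing 0 refl) (vanishing 1 refl) ⟨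
  trinomialSum n (splitRolesWeight n)
    ∎)
  where
  term : ℕ → ℕ → ℕ
  term q c = (n C q) * ((n ∸ q) C c) * ((2 ^ (n ∸ c ∸ q) ∸ 1) ^ c)
  h : ℕ → ℕ
  h q = (n C q) * binomialSum (n ∸ q) (splitRolesWeight n q)
  vanishing : ∀ q → 𝟙 (2 ≤ᵇ q) ≡ 0 → h q ≡ 0
  vanishing q q<2 = begin
    (n C q) * binomialSum (n ∸ q) (splitRolesWeight n q)
      ≡⟨ cong ((n C q) *_) (binomialSum-cong (n ∸ q) (λ c _ → cong (_* ((2 ^ (n ∸ c ∸ q) ∸ 1) ^ c)) q<2)) ⟩
    (n C q) * binomialSum (n ∸ q) (λ _ → 0)
      ≡⟨ cong ((n C q) *_) (binomialSum-vanishes (n ∸ q)) ⟩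
    (n C q) * 0
      ≡⟨ *-zeroʳ (n C q) ⟩
    0 ∎
  row : ∀ q → 𝟙 (2 ≤ᵇ q) ≡ 1 → ∑ (upTo (suc (n ∸ q))) (term q) ≡ h q
  row q 2≤q = begin
    ∑ (upTo (suc (n ∸ q))) (term q)
      ≡⟨ ∑-upTo (suc (n ∸ q)) (term q) ⟩
    ∑< (suc (n ∸ q)) (term q)
      ≡⟨ ∑<-cong (suc (n ∸ q)) (λ c _ → trans (*-assoc (n C q) ((n ∸ q) C c) _)
                                             (cong (λ k → (n C q) * (((n ∸ q) C c) * k)) (weight c))) ⟩
    ∑< (suc (n ∸ q)) (λ c → (n C q) * (((n ∸ q) C c) * splitRolesWeight n q c))
      ≡⟨ ∑<-*ˡ (suc (n ∸ q)) (n C q) (λ c → ((n ∸ q) C c) * splitRolesWeight n q c) ⟩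
    h q ∎
    where
    weight : ∀ c → (2 ^ (n ∸ c ∸ q) ∸ 1) ^ c ≡ splitRolesWeight n q c
    weight c = sym (trans (cong (_* ((2 ^ (n ∸ c ∸ q) ∸ 1) ^ c)) 2≤q) (*-identityˡ _))

lemma7p7 : (n : ℕ) → numSplitQ2 n ≡ formula n
lemma7p7 n = begin
  numSplitQ2 n
    ≡⟨ length-filter≡∑ counted? (allAdjMats n) ⟩
  ∑ (allAdjMats n) (λ A → 𝟙 (does (counted? A)))
    ≡⟨ ∑-allAdjMats n _ (λ A ¬graph → 𝟙-does (counted? A) (⊥-elim ∘ ¬graph ∘ proj₁) (λ _ → refl)) ⟩
  ∑ (allGraphs n) (λ G → 𝟙 (does (counted? (toAdjMat G))))
    ≡⟨ ∑-cong (allGraphs n) (λ G → 𝟙-does (counted? (toAdjMat G)) (counted⇒#SplitRoles±≡1 G)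
                                                                   (¬counted⇒#SplitRoles±≡0 G)) ⟩
  ∑ (allGraphs n) #SplitRoles±
    ≡⟨ ∑-+ (allGraphs n) #SplitRoles (#SplitRoles ∘ complement) ⟩
  ∑ (allGraphs n) #SplitRoles + ∑ (allGraphs n) (#SplitRoles ∘ complement)
    ≡⟨ cong (∑ (allGraphs n) #SplitRoles +_) (trans (∑-complement n #SplitRoles) (sym (+-identityʳ _))) ⟩
  2 * ∑ (allGraphs n) #SplitRoles
    ≡⟨ cong (2 *_) (∑-#SplitRoles n) ⟩
  2 * trinomialSum n (splitRolesWeight n)
    ≡⟨ formula≡trinomialSum n ⟨
  formula n
    ∎
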